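{- Let $q=12n+1$ be a prime power ($n$ a positive integer) and let $C^6$ be the subgroup of index $6$ of the multiplicative group $\mathbb{F}_q^*$. Assume there exists a $16$-tuple $(a_1,\dots,a_{16})$ of elements of $\mathbb{F}_q^*$ such that: (i) each of the four lists $\Delta_{0,0}=(a_1-a_2,\ a_5-a_6,\ a_{10}-a_{11},\ a_{10}-a_{12},\ a_{11}-a_{12},\ a_{15}-a_{16})$, $\Delta_{0,1}=(a_1-a_3,\ a_2-a_3,\ a_5-a_7,\ a_6-a_7,\ a_{14}-a_{15},\ a_{14}-a_{16})$, $\Delta_{1,0}=(a_1-a_4,\ a_2-a_4,\ a_5-a_8,\ a_6-a_8,\ a_{13}-a_{15},\ a_{13}-a_{16})$, $\Delta_{1,1}=(a_3-a_4,\ a_7-a_8,\ a_9-a_{10},\ a_9-a_{11},\ a_9-a_{12},\ a_{13}-a_{14})$ is a complete system of representatives for the six cosets of $C^6$ in $\mathbb{F}_q^*$ (i.e., its six entries are nonzero and lie in six distinct cosets); and (ii) each of the four lists $U_{0,0}=(a_1,a_2,a_5,a_6,a_9)$, $U_{0,1}=(a_3,a_7,a_{13})$, $U_{1,0}=(a_4,a_8,a_{14})$, $U_{1,1}=(a_{10},a_{11},a_{12},a_{15},a_{16})$ is a partial system of representatives for the cosets of $C^6$ in $\mathbb{F}_q^*$ distinct from $C^6$ (i.e., its entries lie in pairwise distinct cosets of $C^6$, none of them equal to $C^6$). Then there exists a nested $(4q,4,1)$-BIBD.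
   Context: A $(v,k,\lambda)$-BIBD is a pair $(X,\mathcal{A})$ with $|X|=v$ and $\mathcal{A}$ a collection of $k$-subsets (blocks) such that every pair of distinct points lies in exactly $\lambda$ blocks; a partial one has "at most $\lambda$". A nested $(v,k,\lambda)$-BIBD is a $(v,k,\lambda)$-BIBD $(X,\mathcal{A})$ together with a map $\phi:\mathcal{A}\to X$ such that $(X,\{A\cup\{\phi(A)\}:A\in\mathcal{A}\})$ is a partial $(v,k+1,\lambda+1)$-BIBD (augmented blocks of size $k+1$). -}

module Defs where

open import Level using (0ℓ)
open import Data.Nat using (ℕ; suc; _≤_)
open import Data.Fin using (Fin; #_)
open import Data.Fin.Properties using (_≟_)
open import Data.Vec using (Vec; _∷_; toList)
open import Data.List using (List; []; _∷_; map; length; filter)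
open import Data.List.Relation.Unary.All using (All)
open import Data.List.Relation.Unary.AllPairs using (AllPairs)
open import Data.Product using (Σ; ∃; _×_; _,_; proj₁; proj₂)
open import Relation.Nullary using (¬_)
open import Relation.Nullary.Decidable using (_×-dec_)
open import Relation.Binary.PropositionalEquality using (_≡_; _≢_)
import Relation.Binary.PropositionalEquality as ≡
open import Algebra.Bundles using (CommutativeRing)
open import Function.Bundles using (Inverse)

record FiniteField (q : ℕ) : Set₁ where
  field
    cring : CommutativeRing 0ℓ 0ℓ
  open CommutativeRing cring public
  field
    1≉0     : ¬ (1# ≈ 0#)
    inverse : ∀ x → ¬ (x ≈ 0#) → ∃ λ y → x * y ≈ 1#
    enum    : Inverse setoid (≡.setoid (Fin q))

-- Cyclotomic classes of index 6: C^6 is the subgroup of sixth powers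
-- of F_q^* (the unique subgroup of index 6 when 6 ∣ q - 1).

module Cyclotomy {q : ℕ} (F : FiniteField q) where
  open FiniteField F

  pow6 : Carrier → Carrier
  pow6 x = x * (x * (x * (x * (x * x))))

  InC6 : Carrier → Set
  InC6 x = ∃ λ z → ¬ (z ≈ 0#) × x ≈ pow6 z

  SameCoset : Carrier → Carrier → Set
  SameCoset x y = ∃ λ c → InC6 c × x ≈ c * y

  NonZero : Carrier → Set
  NonZero x = ¬ (x ≈ 0#)

  CompleteSystem : List Carrier → Set
  CompleteSystem l = length l ≡ 6 × All NonZero l
                     × AllPairs (λ x y → ¬ SameCoset x y) l

  PartialSystemNonC6 : List Carrier → Set
  PartialSystemNonC6 l = All (λ x → NonZero x × ¬ InC6 x) l
                         × AllPairs (λ x y → ¬ SameCoset x y) l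

  module Lists (a : Fin 16 → Carrier) where
    a₁ = a (# 0)
    a₂ = a (# 1)
    a₃ = a (# 2)
    a₄ = a (# 3)
    a₅ = a (# 4)
    a₆ = a (# 5)
    a₇ = a (# 6)
    a₈ = a (# 7)
    a₉ = a (# 8)
    a₁₀ = a (# 9)
    a₁₁ = a (# 10)
    a₁₂ = a (# 11)
    a₁₃ = a (# 12)
    a₁₄ = a (# 13)
    a₁₅ = a (# 14)
    a₁₆ = a (# 15)

    Δ₀₀ Δ₀₁ Δ₁₀ Δ₁₁ U₀₀ U₀₁ U₁₀ U₁₁ : List Carrier
    Δ₀₀ = (a₁ - a₂) ∷ (a₅ - a₆) ∷ (a₁₀ - a₁₁) ∷ (a₁₀ - a₁₂) ∷ (a₁₁ - a₁₂) ∷ (a₁₅ - a₁₆) ∷ []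
    Δ₀₁ = (a₁ - a₃) ∷ (a₂ - a₃) ∷ (a₅ - a₇) ∷ (a₆ - a₇) ∷ (a₁₄ - a₁₅) ∷ (a₁₄ - a₁₆) ∷ []
    Δ₁₀ = (a₁ - a₄) ∷ (a₂ - a₄) ∷ (a₅ - a₈) ∷ (a₆ - a₈) ∷ (a₁₃ - a₁₅) ∷ (a₁₃ - a₁₆) ∷ []
    Δ₁₁ = (a₃ - a₄) ∷ (a₇ - a₈) ∷ (a₉ - a₁₀) ∷ (a₉ - a₁₁) ∷ (a₉ - a₁₂) ∷ (a₁₃ - a₁₄) ∷ []
    U₀₀ = a₁ ∷ a₂ ∷ a₅ ∷ a₆ ∷ a₉ ∷ []
    U₀₁ = a₃ ∷ a₇ ∷ a₁₃ ∷ []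
    U₁₀ = a₄ ∷ a₈ ∷ a₁₄ ∷ []
    U₁₁ = a₁₀ ∷ a₁₁ ∷ a₁₂ ∷ a₁₅ ∷ a₁₆ ∷ []

  Hypotheses : (Fin 16 → Carrier) → Set
  Hypotheses a =
    (∀ i → NonZero (a i))
    × (CompleteSystem Δ₀₀ × CompleteSystem Δ₀₁ × CompleteSystem Δ₁₀ × CompleteSystem Δ₁₁)
    × (PartialSystemNonC6 U₀₀ × PartialSystemNonC6 U₀₁
       × PartialSystemNonC6 U₁₀ × PartialSystemNonC6 U₁₁)
    where open Lists a

-- Designs on the point set Fin v; a block of size k is a Vec of k
-- pairwise distinct points; the block collection is a list (multiset).

module _ {v : ℕ} where
  open import Data.List.Membership.DecPropositional (_≟_ {v}) using (_∈?_)

  pairCount : ∀ {k} → Fin v → Fin v → List (Vec (Fin v) k) → ℕ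
  pairCount x y bs = length (filter (λ B → (x ∈? toList B) ×-dec (y ∈? toList B)) bs)

ValidBlocks : ∀ {v k} → List (Vec (Fin v) k) → Set
ValidBlocks bs = All (λ B → AllPairs _≢_ (toList B)) bs

IsBIBD : (v k lam : ℕ) → List (Vec (Fin v) k) → Set
IsBIBD v k lam bs = ValidBlocks bs × (∀ x y → x ≢ y → pairCount x y bs ≡ lam)

IsPartialBIBD : (v k lam : ℕ) → List (Vec (Fin v) k) → Set
IsPartialBIBD v k lam bs = ValidBlocks bs × (∀ x y → x ≢ y → pairCount x y bs ≤ lam)

-- nested (v,k,λ)-BIBD: blocks paired with their nested point φ(A);
-- the blocks form a (v,k,λ)-BIBD and the augmented blocks A ∪ {φ(A)}
-- (of size k+1, so φ(A) ∉ A) form a partial (v,k+1,λ+1)-BIBD.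
record NestedBIBD (v k lam : ℕ) : Set where
  field
    blocks : List (Vec (Fin v) k × Fin v)
    design : IsBIBD v k lam (map proj₁ blocks)
    nested : IsPartialBIBD v (suc k) (suc lam) (map (λ { (B , p) → p ∷ B }) blocks)

-- Points are F_q × Z₂²: the base point aᵢ carries the label g ∈ Z₂² of the list U_g containing it, and
-- a₁,…,a₁₆ form four base blocks of four points. The blocks are the q fibres {t} × Z₂², with nested
-- point (t + 1, 0), and the translates s·B + (t, g) of the base blocks B, for s in a set S of
-- representatives of C⁶/{±1}, with nested point (t, g).
-- As q ≡ 1 (mod 4), -1 is a square and so lies in C⁶; and C⁶ has at most six cosets. Hence the complete
-- systems Δ_d say that a difference (δ, d) with δ ≠ 0 arises, for exactly one s ∈ S and one pair of
-- points of one base block, as ± s times the difference of that pair: every pair of points lies in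
-- exactly one block. A nested point differs from the other points of its block by (±1, g) for a fibre
-- and by (± s·aᵢ, label of aᵢ) otherwise; the partial systems U_g keep all these differences distinct
-- and outside C⁶, so no pair of points is a nested pair twice.
module Submission where

open import Level using (0ℓ)
open import Data.Nat as ℕ using (ℕ; zero; suc; z≤n; s≤s)
import Data.Nat.Properties as ℕ
open import Data.Integer as ℤ using (ℤ; +_; -[1+_])
import Data.Integer.Properties as ℤ
open import Data.Sign using (Sign)
open import Data.Bool using (Bool; true; false; _∧_; if_then_else_)
open import Data.Fin as Fin using (Fin; toℕ; #_)
import Data.Fin.Properties as Fin
open import Data.Fin.Patterns using (0F; 1F; 2F; 3F; 4F; 5F)
open import Data.Fin.Permutation using (permutation)
open import Data.List using (List; []; _∷_; length; filter; map; allFin; lookup)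
open import Data.List.Properties using (filter-accept; filter-none; filter-some)
open import Data.List.Relation.Unary.All as All using (All; []; _∷_)
import Data.List.Relation.Unary.All.Properties as All
open import Data.List.Relation.Unary.Any using (here; there)
open import Data.List.Relation.Unary.AllPairs using (AllPairs; []; _∷_)
import Data.List.Relation.Unary.AllPairs.Properties as AllPairs
open import Data.List.Relation.Unary.Unique.Propositional using (Unique)
import Data.List.Relation.Unary.Unique.Propositional.Properties as Unique
open import Data.List.Membership.Propositional using (_∈_; lose)
open import Data.List.Membership.Propositional.Properties
  using (∈-map⁺; ∈-allFin; ∈-filter⁺; ∈-filter⁻; ∈-tabulate⁺; ∈-tabulate⁻)
open import Data.Vec using (Vec)
import Data.Vec as Vec
open import Data.Maybe using (Maybe; just; nothing)
open import Data.Product using (∃; ∃₂; _×_; _,_; proj₁; proj₂)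
open import Data.Product.Properties using (,-injective; ≡-dec)
open import Data.Product.Function.NonDependent.Propositional using (_×-↔_)
open import Data.Sum using (_⊎_; inj₁; inj₂; [_,_])
open import Data.Sum.Properties using (inj₂-injective)
open import Data.Sum.Function.Propositional using (_⊎-↔_)
open import Data.Empty using (⊥; ⊥-elim)
open import Data.Unit using (⊤; tt)
open import Function using (_∘_; id)
open import Function.Bundles using (_⇔_; mk⇔; Inverse; Injection; _↔_; mk↔ₛ′)
open import Function.Properties.Inverse using (↔-trans; ↔-refl; ↔-sym; ↔⇒↣)
open import Relation.Nullary using (¬_; Dec; yes; no; does)
open import Relation.Nullary.Decidable
  using (dec-true; dec-false; does-⇔; toWitness; _×-dec_; _⊎-dec_; _→-dec_; ¬?)
open import Relation.Unary using (Pred; Decidable)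
open import Relation.Binary.Definitions using (tri<; tri≈; tri>)
open import Relation.Binary.PropositionalEquality as ≡ using (_≡_; _≢_)
open import Algebra.Bundles using (CommutativeRing)
open import Algebra.Solver.Ring.AlmostCommutativeRing
  using (fromCommutativeRing; _-Raw-AlmostCommutative⟶_)

open import Defs

-- Algebra.Solver.Ring needs a coefficient ring whose equality computes; ℤ maps into every commutative ring.
module RingSolverℤ (R : CommutativeRing 0ℓ 0ℓ) where
  open CommutativeRing R
  open import Algebra.Properties.Semiring.Mult.TCOptimised semiring
    using (×-homo-+; ×1-homo-*; 1+×) renaming (_×_ to _·_)
  open import Algebra.Properties.Ring ring using (-‿distribˡ-*; -‿distribʳ-*)
  open import Algebra.Properties.AbelianGroup +-abelianGroup
    using (⁻¹-∙-comm; ⁻¹-involutive; ε⁻¹≈ε)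
  open import Relation.Binary.Reasoning.Setoid setoid

  fromℕ : ℕ → Carrier
  fromℕ n = n · 1#

  fromℤ : ℤ → Carrier
  fromℤ (+ n)    = fromℕ n
  fromℤ -[1+ n ] = - fromℕ (suc n)

  fromℤ-neg : ∀ i → fromℤ (ℤ.- i) ≈ - fromℤ i
  fromℤ-neg (+ zero)  = sym ε⁻¹≈ε
  fromℤ-neg (+ suc n) = refl
  fromℤ-neg -[1+ n ]  = sym (⁻¹-involutive _)

  [1+a]-[1+b]≈a-b : ∀ a b → (1# + a) - (1# + b) ≈ a - b
  [1+a]-[1+b]≈a-b a b = begin
    (1# + a) + - (1# + b)   ≈⟨ +-congˡ (sym (⁻¹-∙-comm 1# b)) ⟩
    (1# + a) + (- 1# + - b) ≈⟨ +-cong (+-comm 1# a) (+-comm (- 1#) (- b)) ⟩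
    (a + 1#) + (- b + - 1#) ≈⟨ +-assoc a 1# _ ⟩
    a + (1# + (- b + - 1#)) ≈⟨ +-congˡ (+-comm 1# _) ⟩
    a + ((- b + - 1#) + 1#) ≈⟨ +-congˡ (+-assoc (- b) (- 1#) 1#) ⟩
    a + (- b + (- 1# + 1#)) ≈⟨ +-congˡ (+-congˡ (-‿inverseˡ 1#)) ⟩
    a + (- b + 0#)          ≈⟨ +-congˡ (+-identityʳ (- b)) ⟩
    a - b                   ∎

  fromℤ-⊖ : ∀ m n → fromℤ (m ℤ.⊖ n) ≈ fromℕ m - fromℕ n
  fromℤ-⊖ zero    zero    = sym (-‿inverseʳ 0#)
  fromℤ-⊖ zero    (suc n) = sym (+-identityˡ _)
  fromℤ-⊖ (suc m) zero    = sym (trans (+-congˡ ε⁻¹≈ε) (+-identityʳ _))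
  fromℤ-⊖ (suc m) (suc n) = begin
    fromℤ (suc m ℤ.⊖ suc n)     ≡⟨ ≡.cong fromℤ (ℤ.[1+m]⊖[1+n]≡m⊖n m n) ⟩
    fromℤ (m ℤ.⊖ n)             ≈⟨ fromℤ-⊖ m n ⟩
    fromℕ m - fromℕ n           ≈⟨ sym ([1+a]-[1+b]≈a-b (fromℕ m) (fromℕ n)) ⟩
    (1# + fromℕ m) - (1# + fromℕ n) ≈⟨ +-cong (sym (1+× m 1#)) (-‿cong (sym (1+× n 1#))) ⟩
    fromℕ (suc m) - fromℕ (suc n) ∎

  fromℤ-+ : ∀ i j → fromℤ (i ℤ.+ j) ≈ fromℤ i + fromℤ j
  fromℤ-+ (+ m)    (+ n)    = ×-homo-+ 1# m n
  fromℤ-+ (+ m)    -[1+ n ] = fromℤ-⊖ m (suc n)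
  fromℤ-+ -[1+ m ] (+ n)    = trans (fromℤ-⊖ n (suc m)) (+-comm _ _)
  fromℤ-+ -[1+ m ] -[1+ n ] = begin
    - fromℕ (suc (suc (m ℕ.+ n)))   ≡⟨ ≡.cong (λ k → - fromℕ (suc k)) (≡.sym (ℕ.+-suc m n)) ⟩
    - fromℕ (suc m ℕ.+ suc n)       ≈⟨ -‿cong (×-homo-+ 1# (suc m) (suc n)) ⟩
    - (fromℕ (suc m) + fromℕ (suc n)) ≈⟨ sym (⁻¹-∙-comm _ _) ⟩
    - fromℕ (suc m) + - fromℕ (suc n) ∎

  fromℤ-+◃ : ∀ k → fromℤ (Sign.+ ℤ.◃ k) ≈ fromℕ k
  fromℤ-+◃ zero    = refl
  fromℤ-+◃ (suc k) = refl

  fromℤ--◃ : ∀ k → fromℤ (Sign.- ℤ.◃ k) ≈ - fromℕ k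
  fromℤ--◃ zero    = sym ε⁻¹≈ε
  fromℤ--◃ (suc k) = refl

  fromℤ-* : ∀ i j → fromℤ (i ℤ.* j) ≈ fromℤ i * fromℤ j
  fromℤ-* (+ m) (+ n) = trans (fromℤ-+◃ (m ℕ.* n)) (×1-homo-* m n)
  fromℤ-* (+ m) -[1+ n ] = begin
    fromℤ (Sign.- ℤ.◃ (m ℕ.* suc n)) ≈⟨ fromℤ--◃ (m ℕ.* suc n) ⟩
    - fromℕ (m ℕ.* suc n)            ≈⟨ -‿cong (×1-homo-* m (suc n)) ⟩
    - (fromℕ m * fromℕ (suc n))      ≈⟨ -‿distribʳ-* _ _ ⟩
    fromℕ m * - fromℕ (suc n)        ∎
  fromℤ-* -[1+ m ] (+ n) = begin
    fromℤ (Sign.- ℤ.◃ (suc m ℕ.* n)) ≈⟨ fromℤ--◃ (suc m ℕ.* n) ⟩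
    - fromℕ (suc m ℕ.* n)            ≈⟨ -‿cong (×1-homo-* (suc m) n) ⟩
    - (fromℕ (suc m) * fromℕ n)      ≈⟨ -‿distribˡ-* _ _ ⟩
    - fromℕ (suc m) * fromℕ n        ∎
  fromℤ-* -[1+ m ] -[1+ n ] = begin
    fromℤ (Sign.+ ℤ.◃ (suc m ℕ.* suc n))  ≈⟨ fromℤ-+◃ (suc m ℕ.* suc n) ⟩
    fromℕ (suc m ℕ.* suc n)               ≈⟨ ×1-homo-* (suc m) (suc n) ⟩
    x * y                                 ≈⟨ *-congʳ (sym (⁻¹-involutive x)) ⟩
    - - x * y                             ≈⟨ sym (-‿distribˡ-* (- x) y) ⟩
    - (- x * y)                           ≈⟨ -‿distribʳ-* (- x) y ⟩
    - x * - y                             ∎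
    where x = fromℕ (suc m); y = fromℕ (suc n)

  ℤ⟶R : CommutativeRing.rawRing ℤ.+-*-commutativeRing
          -Raw-AlmostCommutative⟶ fromCommutativeRing R
  ℤ⟶R = record
    { ⟦_⟧ = fromℤ ; +-homo = fromℤ-+ ; *-homo = fromℤ-* ; -‿homo = fromℤ-neg
    ; 0-homo = refl ; 1-homo = refl }

  fromℤ-≟ : ∀ i j → Maybe (fromℤ i ≈ fromℤ j)
  fromℤ-≟ i j with i ℤ.≟ j
  ... | yes ≡.refl = just refl
  ... | no _     = nothing

  open import Algebra.Solver.Ring _ (fromCommutativeRing R) ℤ⟶R fromℤ-≟ public
    using (solve; _:=_; con; _:+_; _:*_; :-_; _:-_)


module ListCount {A : Set} where

  count : {P : Pred A 0ℓ} → Decidable P → List A → ℕ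
  count P? xs = length (filter P? xs)

  module _ {P : Pred A 0ℓ} (P? : Decidable P) where

    count≤1 : ∀ {xs} → Unique xs → (∀ {x y} → x ∈ xs → y ∈ xs → P x → P y → x ≡ y) → count P? xs ℕ.≤ 1
    count≤1 {[]}     _          _     = z≤n
    count≤1 {x ∷ xs} (x∉ ∷ xs!) P-once with P? x
    ... | no _   = count≤1 xs! (λ y∈ z∈ → P-once (there y∈) (there z∈))
    ... | yes px = s≤s (ℕ.≤-reflexive (≡.cong length (filter-none P? (All.tabulate ¬P))))
      where
      ¬P : ∀ {y} → y ∈ xs → ¬ P y
      ¬P y∈ py = All.lookup x∉ y∈ (P-once (here ≡.refl) (there y∈) px py)

    count≡1 : ∀ {xs x} → Unique xs → (∀ {y z} → y ∈ xs → z ∈ xs → P y → P z → y ≡ z)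
            → x ∈ xs → P x → count P? xs ≡ 1
    count≡1 xs! P-once x∈ px = ℕ.≤-antisym (count≤1 xs! P-once) (filter-some P? (lose x∈ px))

    count-map : ∀ {B : Set} (f : B → A) (ys : List B) → count P? (map f ys) ≡ length (filter (P? ∘ f) ys)
    count-map f []       = ≡.refl
    count-map f (y ∷ ys) with does (P? (f y))
    ... | true  = ≡.cong suc (count-map f ys)
    ... | false = count-map f ys

  count-∷ : ∀ {P : Pred A 0ℓ} (P? : Decidable P) x xs → count P? xs ℕ.≤ count P? (x ∷ xs)
  count-∷ P? x xs with does (P? x)
  ... | true  = ℕ.n≤1+n _
  ... | false = ℕ.≤-refl

  count-⊎ : ∀ {P Q R : Pred A 0ℓ} (P? : Decidable P) (Q? : Decidable Q) (R? : Decidable R)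
          → (∀ {x} → P x → Q x ⊎ R x) → ∀ xs → count P? xs ℕ.≤ count Q? xs ℕ.+ count R? xs
  count-⊎ P? Q? R? P⊆Q∪R []       = z≤n
  count-⊎ P? Q? R? P⊆Q∪R (x ∷ xs) with P? x
  ... | no _ = ℕ.≤-trans ih (ℕ.+-mono-≤ (count-∷ Q? x xs) (count-∷ R? x xs))
    where ih = count-⊎ P? Q? R? P⊆Q∪R xs
  ... | yes px with P⊆Q∪R px
  ...   | inj₁ qx rewrite filter-accept Q? {x} {xs} qx =
    s≤s (ℕ.≤-trans (count-⊎ P? Q? R? P⊆Q∪R xs) (ℕ.+-monoʳ-≤ (count Q? xs) (count-∷ R? x xs)))
  ...   | inj₂ rx rewrite filter-accept R? {x} {xs} rx | ℕ.+-suc (count Q? (x ∷ xs)) (count R? xs) =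
    s≤s (ℕ.≤-trans (count-⊎ P? Q? R? P⊆Q∪R xs) (ℕ.+-monoˡ-≤ (count R? xs) (count-∷ Q? x xs)))

module FinCount where
  open import Algebra.Properties.CommutativeMonoid.Sum ℕ.+-0-commutativeMonoid
    using (sum; sum-permute; ∑-distrib-+; sum-cong-≗)

  count : ∀ {m} {P : Pred (Fin m) 0ℓ} → Decidable P → ℕ
  count P? = sum (λ i → if does (P? i) then 1 else 0)

  count-cong : ∀ {m} {P Q : Pred (Fin m) 0ℓ} (P? : Decidable P) (Q? : Decidable Q)
             → (∀ i → P i ⇔ Q i) → count P? ≡ count Q?
  count-cong P? Q? P⇔Q = sum-cong-≗ (λ i → ≡.cong (if_then 1 else 0) (does-⇔ (P⇔Q i) (P? i) (Q? i)))

  count-all : ∀ {m} {P : Pred (Fin m) 0ℓ} (P? : Decidable P) → (∀ i → P i) → count P? ≡ m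
  count-all {zero}  P? all = ≡.refl
  count-all {suc m} P? all rewrite dec-true (P? Fin.zero) (all Fin.zero) =
    ≡.cong suc (count-all (P? ∘ Fin.suc) (all ∘ Fin.suc))

  count-none : ∀ {m} {P : Pred (Fin m) 0ℓ} (P? : Decidable P) → (∀ i → ¬ P i) → count P? ≡ 0
  count-none {zero}  P? none = ≡.refl
  count-none {suc m} P? none rewrite dec-false (P? Fin.zero) (none Fin.zero) =
    count-none (P? ∘ Fin.suc) (none ∘ Fin.suc)

  count-unique : ∀ {m} {P : Pred (Fin m) 0ℓ} (P? : Decidable P) {c : Fin m}
               → P c → (∀ {i} → P i → i ≡ c) → count P? ≡ 1
  count-unique P? {Fin.zero} pc unique rewrite dec-true (P? Fin.zero) pc =
    ≡.cong suc (count-none (P? ∘ Fin.suc) (λ i p → Fin.0≢1+n (≡.sym (unique p))))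
  count-unique {suc m} P? {Fin.suc c} pc unique rewrite dec-false (P? Fin.zero) (λ p → Fin.0≢1+n (unique p)) =
    count-unique (P? ∘ Fin.suc) pc (Fin.suc-injective ∘ unique)

  -- A 2-cycle {i, σ i} inside P is counted once, at its smaller element.
  count-involution
    : ∀ {m} {P : Pred (Fin m) 0ℓ} (P? : Decidable P) (σ : Fin m → Fin m)
    → (∀ {i} → P i → P (σ i)) → (∀ {i} → P i → σ (σ i) ≡ i)
    → count P? ≡ count (λ i → P? i ×-dec (σ i Fin.≟ i))
                 ℕ.+ 2 ℕ.* count (λ i → P? i ×-dec (toℕ i ℕ.<? toℕ (σ i)))
  count-involution {m} {P} P? σ σ-closed σ-involutive = begin
    count P?                                    ≡⟨ sum-cong-≗ split ⟩
    sum (λ i → fixed i ℕ.+ (below i ℕ.+ above i)) ≡⟨ ∑-distrib-+ fixed _ ⟩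
    sum fixed ℕ.+ sum (λ i → below i ℕ.+ above i) ≡⟨ ≡.cong (sum fixed ℕ.+_) (∑-distrib-+ below above) ⟩
    sum fixed ℕ.+ (sum below ℕ.+ sum above)       ≡⟨ ≡.cong (λ s → sum fixed ℕ.+ (sum below ℕ.+ s)) above≡below ⟩
    sum fixed ℕ.+ (sum below ℕ.+ sum below)       ≡⟨ ≡.cong (λ s → sum fixed ℕ.+ (sum below ℕ.+ s)) (≡.sym (ℕ.+-identityʳ _)) ⟩
    sum fixed ℕ.+ 2 ℕ.* sum below                 ∎
    where
    open ≡.≡-Reasoning
    ind : Bool → ℕ
    ind b = if b then 1 else 0
    fixed below above : Fin m → ℕ
    fixed i = ind (does (P? i) ∧ does (σ i Fin.≟ i))
    below i = ind (does (P? i) ∧ does (toℕ i ℕ.<? toℕ (σ i)))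
    above i = ind (does (P? i) ∧ does (toℕ (σ i) ℕ.<? toℕ i))

    split : ∀ i → ind (does (P? i)) ≡ fixed i ℕ.+ (below i ℕ.+ above i)
    split i with P? i
    ... | no _ = ≡.refl
    ... | yes _ with ℕ.<-cmp (toℕ i) (toℕ (σ i))
    ... | tri< i<σi i≢σi _
      rewrite dec-false (σ i Fin.≟ i) (i≢σi ∘ ≡.cong toℕ ∘ ≡.sym)
            | dec-true (toℕ i ℕ.<? toℕ (σ i)) i<σi
            | dec-false (toℕ (σ i) ℕ.<? toℕ i) (ℕ.<-asym i<σi) = ≡.refl
    ... | tri≈ _ i≡σi _
      rewrite dec-true (σ i Fin.≟ i) (≡.sym (Fin.toℕ-injective i≡σi))
            | dec-false (toℕ i ℕ.<? toℕ (σ i)) (ℕ.<-irrefl i≡σi)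
            | dec-false (toℕ (σ i) ℕ.<? toℕ i) (ℕ.<-irrefl (≡.sym i≡σi)) = ≡.refl
    ... | tri> _ i≢σi σi<i
      rewrite dec-false (σ i Fin.≟ i) (i≢σi ∘ ≡.cong toℕ ∘ ≡.sym)
            | dec-false (toℕ i ℕ.<? toℕ (σ i)) (ℕ.<-asym σi<i)
            | dec-true (toℕ (σ i) ℕ.<? toℕ i) σi<i = ≡.refl

    τ : Fin m → Fin m
    τ i = if does (P? i) then σ i else i

    τ-involutive : ∀ i → τ (τ i) ≡ i
    τ-involutive i with P? i
    ... | no ¬p rewrite dec-false (P? i) ¬p = ≡.refl
    ... | yes p rewrite dec-true (P? (σ i)) (σ-closed p) = σ-involutive p

    above≡below∘τ : ∀ i → above i ≡ below (τ i)
    above≡below∘τ i with P? i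
    ... | no ¬p rewrite dec-false (P? i) ¬p = ≡.refl
    ... | yes p rewrite dec-true (P? (σ i)) (σ-closed p) | σ-involutive p = ≡.refl

    above≡below : sum above ≡ sum below
    above≡below = ≡.trans (sum-cong-≗ above≡below∘τ)
      (≡.sym (sum-permute below (permutation τ τ τ-involutive τ-involutive)))

  count-involution-total
    : ∀ {m} (σ : Fin m → Fin m) → (∀ i → σ (σ i) ≡ i)
    → m ≡ count (λ i → σ i Fin.≟ i) ℕ.+ 2 ℕ.* count (λ i → toℕ i ℕ.<? toℕ (σ i))
  count-involution-total {m} σ σ-involutive = begin
    m                                         ≡⟨ count-all every (λ _ → tt) ⟨
    count every                               ≡⟨ count-involution every σ (λ _ → tt) (λ {i} _ → σ-involutive i) ⟩
    count (every ∩ fixed?) ℕ.+ 2 ℕ.* count (every ∩ below?)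
      ≡⟨ ≡.cong₂ (λ a b → a ℕ.+ 2 ℕ.* b) (count-cong (every ∩ fixed?) fixed? (λ _ → ⊤×-⇔))
                                         (count-cong (every ∩ below?) below? (λ _ → ⊤×-⇔)) ⟩
    count fixed? ℕ.+ 2 ℕ.* count below?       ∎
    where
    open ≡.≡-Reasoning
    every : (i : Fin m) → Dec ⊤
    every _ = yes tt
    fixed? : ∀ i → Dec (σ i ≡ i)
    fixed? i = σ i Fin.≟ i
    below? : ∀ i → Dec (toℕ i ℕ.< toℕ (σ i))
    below? i = toℕ i ℕ.<? toℕ (σ i)
    _∩_ : ∀ {A B : Fin m → Set} → (∀ i → Dec (A i)) → (∀ i → Dec (B i)) → ∀ i → Dec (A i × B i)
    (A? ∩ B?) i = A? i ×-dec B? i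
    ⊤×-⇔ : ∀ {A : Set} → (⊤ × A) ⇔ A
    ⊤×-⇔ = mk⇔ proj₂ (tt ,_)

module _ {A B : Set} {f : A → B} where

  All-map-∈ : ∀ {P : B → Set} {xs x} → All P (map f xs) → x ∈ xs → P (f x)
  All-map-∈ {xs = _ ∷ _} (px ∷ _)   (here ≡.refl) = px
  All-map-∈ {xs = _ ∷ _} (_ ∷ pxs) (there x∈)    = All-map-∈ pxs x∈

  AllPairs-map-∈ : ∀ {R : B → B → Set} → (∀ {x y} → R x y → R y x)
                 → ∀ {xs x y} → AllPairs R (map f xs) → x ∈ xs → y ∈ xs → x ≢ y → R (f x) (f y)
  AllPairs-map-∈ R-sym {_ ∷ _} (_ ∷ _)    (here ≡.refl) (here ≡.refl) x≢y = ⊥-elim (x≢y ≡.refl)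
  AllPairs-map-∈ R-sym {_ ∷ _} (Rx ∷ _)   (here ≡.refl) (there y∈)    _   = All-map-∈ Rx y∈
  AllPairs-map-∈ R-sym {_ ∷ _} (Ry ∷ _)   (there x∈)    (here ≡.refl) _   = R-sym (All-map-∈ Ry x∈)
  AllPairs-map-∈ R-sym {_ ∷ _} (_ ∷ Rxs)  (there x∈)    (there y∈)    x≢y = AllPairs-map-∈ R-sym Rxs x∈ y∈ x≢y

module Enumeration {A : Set} {N : ℕ} (A↔ : Fin N ↔ A) where

  enumerate : List A
  enumerate = map (Inverse.to A↔) (allFin N)

  enumerate-unique : Unique enumerate
  enumerate-unique = Unique.map⁺ (Injection.injective (↔⇒↣ A↔)) (Unique.allFin⁺ N)

  enumerate-complete : ∀ x → x ∈ enumerate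
  enumerate-complete x = ≡.subst (_∈ enumerate) (Inverse.strictlyInverseˡ A↔ x) (∈-map⁺ (Inverse.to A↔) (∈-allFin _))

module FieldProperties {q : ℕ} (F : FiniteField q) where
  open FiniteField F hiding (zero)
  open Cyclotomy F
  open Inverse enum using (to; from; to-cong)
    renaming (strictlyInverseʳ to from-to; strictlyInverseˡ to to-from)
  open RingSolverℤ cring
  open import Algebra.Properties.Group +-group using (x∙y⁻¹≈ε⇒x≈y; x≈y⇒x∙y⁻¹≈ε)
  open import Algebra.Properties.Group +-group public using ()
    renaming (∙-cancelˡ to +-cancelˡ; ∙-cancelʳ to +-cancelʳ)
  open import Relation.Binary.Reasoning.Setoid setoid

  to-injective : ∀ {x y} → to x ≡ to y → x ≈ y
  to-injective {x} {y} tx≡ty = begin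
    x           ≈⟨ from-to x ⟨
    from (to x) ≡⟨ ≡.cong from tx≡ty ⟩
    from (to y) ≈⟨ from-to y ⟩
    y           ∎

  from-injective : ∀ {k l} → from k ≈ from l → k ≡ l
  from-injective {k} {l} fk≈fl = ≡.trans (≡.sym (to-from k)) (≡.trans (to-cong fk≈fl) (to-from l))

  infix 4 _≈?_
  _≈?_ : ∀ x y → Dec (x ≈ y)
  x ≈? y with to x Fin.≟ to y
  ... | yes tx≡ty = yes (to-injective tx≡ty)
  ... | no  tx≢ty = no (tx≢ty ∘ to-cong)

  x-y≈0⇒x≈y : ∀ {x y} → x - y ≈ 0# → x ≈ y
  x-y≈0⇒x≈y = x∙y⁻¹≈ε⇒x≈y _ _

  x≈y⇒x-y≈0 : ∀ {x y} → x ≈ y → x - y ≈ 0#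
  x≈y⇒x-y≈0 = x≈y⇒x∙y⁻¹≈ε

  -- The junk value 0⁻¹ = 0 makes _⁻¹ total.
  _⁻¹ : Carrier → Carrier
  x ⁻¹ with x ≈? 0#
  ... | yes _  = 0#
  ... | no x≉0 = proj₁ (inverse x x≉0)

  ⁻¹-inverseʳ : ∀ {x} → NonZero x → x * x ⁻¹ ≈ 1#
  ⁻¹-inverseʳ {x} x≉0 with x ≈? 0#
  ... | yes x≈0 = ⊥-elim (x≉0 x≈0)
  ... | no x≉0′ = proj₂ (inverse x x≉0′)

  ⁻¹-inverseˡ : ∀ {x} → NonZero x → x ⁻¹ * x ≈ 1#
  ⁻¹-inverseˡ x≉0 = trans (*-comm _ _) (⁻¹-inverseʳ x≉0)

  *-cancelʳ : ∀ {x y z} → NonZero z → x * z ≈ y * z → x ≈ y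
  *-cancelʳ {x} {y} {z} z≉0 xz≈yz = begin
    x               ≈⟨ *-identityʳ x ⟨
    x * 1#          ≈⟨ *-congˡ (⁻¹-inverseʳ z≉0) ⟨
    x * (z * z ⁻¹)  ≈⟨ *-assoc x z (z ⁻¹) ⟨
    x * z * z ⁻¹    ≈⟨ *-congʳ xz≈yz ⟩
    y * z * z ⁻¹    ≈⟨ *-assoc y z (z ⁻¹) ⟩
    y * (z * z ⁻¹)  ≈⟨ *-congˡ (⁻¹-inverseʳ z≉0) ⟩
    y * 1#          ≈⟨ *-identityʳ y ⟩
    y               ∎

  *-cancelˡ : ∀ {x y z} → NonZero z → z * x ≈ z * y → x ≈ y
  *-cancelˡ z≉0 zx≈zy = *-cancelʳ z≉0 (trans (*-comm _ _) (trans zx≈zy (*-comm _ _)))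

  x*y≈0⇒y≈0 : ∀ {x y} → NonZero x → x * y ≈ 0# → y ≈ 0#
  x*y≈0⇒y≈0 {x} x≉0 xy≈0 = *-cancelˡ x≉0 (trans xy≈0 (sym (zeroʳ x)))

  x*y≈0⇒x≈0⊎y≈0 : ∀ {x y} → x * y ≈ 0# → x ≈ 0# ⊎ y ≈ 0#
  x*y≈0⇒x≈0⊎y≈0 {x} xy≈0 with x ≈? 0#
  ... | yes x≈0 = inj₁ x≈0
  ... | no  x≉0 = inj₂ (x*y≈0⇒y≈0 x≉0 xy≈0)

  *-nonZero : ∀ {x y} → NonZero x → NonZero y → NonZero (x * y)
  *-nonZero x≉0 y≉0 = y≉0 ∘ x*y≈0⇒y≈0 x≉0

  ⁻¹-unique : ∀ {x y} → NonZero x → x * y ≈ 1# → y ≈ x ⁻¹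
  ⁻¹-unique x≉0 xy≈1 = *-cancelˡ x≉0 (trans xy≈1 (sym (⁻¹-inverseʳ x≉0)))

  ⁻¹-nonZero : ∀ {x} → NonZero x → NonZero (x ⁻¹)
  ⁻¹-nonZero {x} x≉0 x⁻¹≈0 = 1≉0 (begin
    1#         ≈⟨ ⁻¹-inverseʳ x≉0 ⟨
    x * x ⁻¹   ≈⟨ *-congˡ x⁻¹≈0 ⟩
    x * 0#     ≈⟨ zeroʳ x ⟩
    0#         ∎)

  ⁻¹-cong : ∀ {x y} → NonZero x → x ≈ y → x ⁻¹ ≈ y ⁻¹
  ⁻¹-cong x≉0 x≈y = ⁻¹-unique (x≉0 ∘ trans x≈y) (trans (*-congʳ (sym x≈y)) (⁻¹-inverseʳ x≉0))

  ⁻¹-involutive : ∀ {x} → NonZero x → x ⁻¹ ⁻¹ ≈ x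
  ⁻¹-involutive x≉0 = sym (⁻¹-unique (⁻¹-nonZero x≉0) (⁻¹-inverseˡ x≉0))

  1⁻¹≈1 : 1# ⁻¹ ≈ 1#
  1⁻¹≈1 = sym (⁻¹-unique 1≉0 (*-identityˡ 1#))

  -‿⁻¹ : ∀ {x} → NonZero x → (- x) ⁻¹ ≈ - x ⁻¹
  -‿⁻¹ {x} x≉0 = sym (⁻¹-unique -x≉0 (trans (solve 2 (λ x y → (:- x) :* (:- y) := x :* y) refl x (x ⁻¹)) (⁻¹-inverseʳ x≉0)))
    where
    -x≉0 : NonZero (- x)
    -x≉0 -x≈0 = x≉0 (trans (solve 1 (λ x → x := :- (:- x)) refl x) (trans (-‿cong -x≈0) (solve 0 (:- con (+ 0) := con (+ 0)) refl)))

  pow6-* : ∀ x y → pow6 (x * y) ≈ pow6 x * pow6 y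
  pow6-* = solve 2 (λ x y → (x :* y) :* ((x :* y) :* ((x :* y) :* ((x :* y) :* ((x :* y) :* (x :* y)))))
                   := (x :* (x :* (x :* (x :* (x :* x))))) :* (y :* (y :* (y :* (y :* (y :* y)))))) refl

  pow6-cong : ∀ {x y} → x ≈ y → pow6 x ≈ pow6 y
  pow6-cong x≈y = *-cong x≈y (*-cong x≈y (*-cong x≈y (*-cong x≈y (*-cong x≈y x≈y))))

  pow6-nonZero : ∀ {x} → NonZero x → NonZero (pow6 x)
  pow6-nonZero x≉0 = *-nonZero x≉0 (*-nonZero x≉0 (*-nonZero x≉0 (*-nonZero x≉0 (*-nonZero x≉0 x≉0))))

  pow6-1 : pow6 1# ≈ 1#
  pow6-1 = solve 0 (con (+ 1) :* (con (+ 1) :* (con (+ 1) :* (con (+ 1) :* (con (+ 1) :* con (+ 1))))) := con (+ 1)) refl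

  pow6-⁻¹ : ∀ {x} → NonZero x → pow6 x ⁻¹ ≈ pow6 (x ⁻¹)
  pow6-⁻¹ {x} x≉0 = sym (⁻¹-unique (pow6-nonZero x≉0)
    (trans (sym (pow6-* x (x ⁻¹))) (trans (pow6-cong (⁻¹-inverseʳ x≉0)) pow6-1)))

  InC6-nonZero : ∀ {c} → InC6 c → NonZero c
  InC6-nonZero (z , z≉0 , c≈z⁶) c≈0 = pow6-nonZero z≉0 (trans (sym c≈z⁶) c≈0)

  InC6-resp : ∀ {c d} → c ≈ d → InC6 c → InC6 d
  InC6-resp c≈d (z , z≉0 , c≈z⁶) = z , z≉0 , trans (sym c≈d) c≈z⁶

  InC6-1 : InC6 1#
  InC6-1 = 1# , 1≉0 , sym pow6-1

  InC6-pow6 : ∀ {z} → NonZero z → InC6 (pow6 z)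
  InC6-pow6 z≉0 = _ , z≉0 , refl

  InC6-* : ∀ {c d} → InC6 c → InC6 d → InC6 (c * d)
  InC6-* (z , z≉0 , c≈z⁶) (w , w≉0 , d≈w⁶) =
    z * w , *-nonZero z≉0 w≉0 , trans (*-cong c≈z⁶ d≈w⁶) (sym (pow6-* z w))

  InC6-⁻¹ : ∀ {c} → InC6 c → InC6 (c ⁻¹)
  InC6-⁻¹ c∈C6@(z , z≉0 , c≈z⁶) =
    z ⁻¹ , ⁻¹-nonZero z≉0 , trans (⁻¹-cong (InC6-nonZero c∈C6) c≈z⁶) (pow6-⁻¹ z≉0)

  InC6? : ∀ x → Dec (InC6 x)
  InC6? x with Fin.any? (λ k → ¬? (from k ≈? 0#) ×-dec (x ≈? pow6 (from k)))
  ... | yes (k , k≉0 , x≈k⁶) = yes (from k , k≉0 , x≈k⁶)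
  ... | no ∄k = no λ (z , z≉0 , x≈z⁶) →
    ∄k (to z , z≉0 ∘ trans (sym (from-to z)) , trans x≈z⁶ (pow6-cong (sym (from-to z))))

  c*x≈y⇒x≈c⁻¹*y : ∀ {c x y} → NonZero c → c * x ≈ y → x ≈ c ⁻¹ * y
  c*x≈y⇒x≈c⁻¹*y {c} {x} {y} c≉0 cx≈y = begin
    x                ≈⟨ *-identityˡ x ⟨
    1# * x           ≈⟨ *-congʳ (⁻¹-inverseˡ c≉0) ⟨
    c ⁻¹ * c * x     ≈⟨ *-assoc (c ⁻¹) c x ⟩
    c ⁻¹ * (c * x)   ≈⟨ *-congˡ cx≈y ⟩
    c ⁻¹ * y         ∎

  SameCoset-sym : ∀ {x y} → SameCoset x y → SameCoset y x
  SameCoset-sym (c , c∈C6 , x≈cy) =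
    c ⁻¹ , InC6-⁻¹ c∈C6 , c*x≈y⇒x≈c⁻¹*y (InC6-nonZero c∈C6) (sym x≈cy)

  SameCoset-scaled : ∀ {c c′ x y} → InC6 c → InC6 c′ → c * x ≈ c′ * y → SameCoset x y
  SameCoset-scaled {c} {c′} {x} {y} c∈C6 c′∈C6 cx≈c′y = c ⁻¹ * c′ , InC6-* (InC6-⁻¹ c∈C6) c′∈C6 ,
    trans (c*x≈y⇒x≈c⁻¹*y (InC6-nonZero c∈C6) cx≈c′y) (sym (*-assoc (c ⁻¹) c′ y))

module OddOrder {q m : ℕ} (F : FiniteField q) (q≡1+2m : q ≡ suc (2 ℕ.* m)) where
  open FinCount
  open FiniteField F hiding (zero)
  open Cyclotomy F
  open Inverse enum using (to; from; to-cong)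
    renaming (strictlyInverseʳ to from-to; strictlyInverseˡ to to-from)
  open FieldProperties F
  open RingSolverℤ cring
  open import Relation.Binary.Reasoning.Setoid setoid

  -- Otherwise x ↦ x + 1 would be a fixed-point-free involution of F, and q would be even.
  1+1≉0 : ¬ (1# + 1# ≈ 0#)
  1+1≉0 1+1≈0 = ℕ.even≢odd below m (≡.sym (≡.trans (≡.sym q≡1+2m) counted))
    where
    succ : Fin q → Fin q
    succ k = to (from k + 1#)

    x+1+1≈x : ∀ x → x + 1# + 1# ≈ x
    x+1+1≈x x = begin
      x + 1# + 1#   ≈⟨ +-assoc x 1# 1# ⟩
      x + (1# + 1#) ≈⟨ +-congˡ 1+1≈0 ⟩
      x + 0#        ≈⟨ +-identityʳ x ⟩
      x             ∎

    succ-involutive : ∀ k → succ (succ k) ≡ k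
    succ-involutive k = from-injective (trans (from-to _) (trans (+-congʳ (from-to _)) (x+1+1≈x (from k))))

    succ-fixed-free : ∀ k → succ k ≢ k
    succ-fixed-free k succk≡k = 1≉0 (begin
      1#                     ≈⟨ solve 2 (λ x u → u := (x :+ u) :- x) refl (from k) 1# ⟩
      (from k + 1#) - from k ≈⟨ +-congʳ (from-to _) ⟨
      from (succ k) - from k ≡⟨ ≡.cong (λ l → from l - from k) succk≡k ⟩
      from k - from k        ≈⟨ -‿inverseʳ (from k) ⟩
      0#                     ∎)

    below : ℕ
    below = count (λ k → toℕ k ℕ.<? toℕ (succ k))

    counted : q ≡ 2 ℕ.* below
    counted = ≡.trans (count-involution-total succ succ-involutive)
      (≡.cong (ℕ._+ 2 ℕ.* below) (count-none (λ k → succ k Fin.≟ k) succ-fixed-free))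

  x+x≈0⇒x≈0 : ∀ {x} → x + x ≈ 0# → x ≈ 0#
  x+x≈0⇒x≈0 {x} x+x≈0 = x*y≈0⇒y≈0 1+1≉0 (trans (solve 1 (λ x → (con (+ 1) :+ con (+ 1)) :* x := x :+ x) refl x) x+x≈0)

  0ᶜ : Fin q
  0ᶜ = to 0#

  from-nonZero : ∀ {k} → k ≢ 0ᶜ → NonZero (from k)
  from-nonZero {k} k≢0ᶜ fk≈0 = k≢0ᶜ (≡.trans (≡.sym (to-from k)) (to-cong fk≈0))

  neg : Fin q → Fin q
  neg k = to (- from k)

  from-neg : ∀ k → from (neg k) ≈ - from k
  from-neg k = from-to _

  neg-involutive : ∀ k → neg (neg k) ≡ k
  neg-involutive k = from-injective (trans (from-to _) (trans (-‿cong (from-neg k)) (solve 1 (λ x → :- (:- x) := x) refl (from k))))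

  neg-0ᶜ : neg 0ᶜ ≡ 0ᶜ
  neg-0ᶜ = to-cong (trans (-‿cong (from-to 0#)) (solve 0 (:- con (+ 0) := con (+ 0)) refl))

  neg-fixed⇒≡0ᶜ : ∀ {k} → neg k ≡ k → k ≡ 0ᶜ
  neg-fixed⇒≡0ᶜ {k} negk≡k = ≡.trans (≡.sym (to-from k)) (to-cong (x+x≈0⇒x≈0 (begin
    from k + from k   ≈⟨ +-congˡ (trans (sym (from-neg k)) (≡.subst (λ l → from l ≈ from k) (≡.sym negk≡k) refl)) ⟨
    from k + - from k ≈⟨ -‿inverseʳ (from k) ⟩
    0#                ∎)))

  neg-≢0ᶜ : ∀ {k} → k ≢ 0ᶜ → neg k ≢ 0ᶜ
  neg-≢0ᶜ {k} k≢0ᶜ negk≡0ᶜ = k≢0ᶜ (≡.trans (≡.sym (neg-involutive k)) (≡.trans (≡.cong neg negk≡0ᶜ) neg-0ᶜ))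

  -- One element out of each pair {x, -x} with x ≠ 0 (a half system): the one with the smaller code.
  Positive : Fin q → Set
  Positive k = toℕ k ℕ.< toℕ (neg k)

  Positive? : ∀ k → Dec (Positive k)
  Positive? k = toℕ k ℕ.<? toℕ (neg k)

  Positive⇒≢0ᶜ : ∀ {k} → Positive k → k ≢ 0ᶜ
  Positive⇒≢0ᶜ {k} k<negk ≡.refl = ℕ.<-irrefl (≡.cong toℕ (≡.sym neg-0ᶜ)) k<negk

  Positive⇒¬Positive-neg : ∀ {k} → Positive k → ¬ Positive (neg k)
  Positive⇒¬Positive-neg {k} k<negk negk<k =
    ℕ.<-asym k<negk (≡.subst (λ l → toℕ (neg k) ℕ.< toℕ l) (neg-involutive k) negk<k)

  ¬Positive⇒Positive-neg : ∀ {k} → k ≢ 0ᶜ → ¬ Positive k → Positive (neg k)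
  ¬Positive⇒Positive-neg {k} k≢0ᶜ k≮negk = ≡.subst (λ l → toℕ (neg k) ℕ.< toℕ l) (≡.sym (neg-involutive k))
    (ℕ.≤∧≢⇒< (ℕ.≮⇒≥ k≮negk) (λ negk≡k → k≢0ᶜ (neg-fixed⇒≡0ᶜ (Fin.toℕ-injective negk≡k))))

  count-Positive : count Positive? ≡ m
  count-Positive = ℕ.*-cancelˡ-≡ (count Positive?) m 2 (ℕ.suc-injective (≡.trans (≡.sym counted) q≡1+2m))
    where
    counted : q ≡ 1 ℕ.+ 2 ℕ.* count Positive?
    counted = ≡.trans (count-involution-total neg neg-involutive)
      (≡.cong (ℕ._+ 2 ℕ.* count Positive?) (count-unique (λ k → neg k Fin.≟ k) neg-0ᶜ neg-fixed⇒≡0ᶜ))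

  abs : Fin q → Fin q
  abs k with Positive? k
  ... | yes _ = k
  ... | no _  = neg k

  abs-cases : ∀ k → abs k ≡ k ⊎ abs k ≡ neg k
  abs-cases k with Positive? k
  ... | yes _ = inj₁ ≡.refl
  ... | no _  = inj₂ ≡.refl

  abs-Positive : ∀ {k} → Positive k → abs k ≡ k
  abs-Positive {k} k+ with Positive? k
  ... | yes _  = ≡.refl
  ... | no k≮ = ⊥-elim (k≮ k+)

  abs-¬Positive : ∀ {k} → ¬ Positive k → abs k ≡ neg k
  abs-¬Positive {k} k≮ with Positive? k
  ... | yes k+ = ⊥-elim (k≮ k+)
  ... | no _   = ≡.refl

  Positive-abs : ∀ {k} → k ≢ 0ᶜ → Positive (abs k)
  Positive-abs {k} k≢0ᶜ with Positive? k
  ... | yes k+ = k+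
  ... | no k≮ = ¬Positive⇒Positive-neg k≢0ᶜ k≮

  abs-neg : ∀ {k} → k ≢ 0ᶜ → abs (neg k) ≡ abs k
  abs-neg {k} k≢0ᶜ with Positive? k
  ... | yes k+ = ≡.trans (abs-¬Positive (Positive⇒¬Positive-neg k+)) (neg-involutive k)
  ... | no k≮ = abs-Positive (¬Positive⇒Positive-neg k≢0ᶜ k≮)

  Positive-≉-neg : ∀ {k l} → Positive k → Positive l → ¬ (from k ≈ - from l)
  Positive-≉-neg {k} {l} k+ l+ fk≈-fl =
    Positive⇒¬Positive-neg l+ (≡.subst Positive (from-injective (trans fk≈-fl (sym (from-neg l)))) k+)

  recip : Fin q → Fin q
  recip k = to (from k ⁻¹)

  recip-≢0ᶜ : ∀ {k} → k ≢ 0ᶜ → recip k ≢ 0ᶜ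
  recip-≢0ᶜ k≢0ᶜ recipk≡0ᶜ = ⁻¹-nonZero (from-nonZero k≢0ᶜ) (to-injective recipk≡0ᶜ)

  recip-involutive : ∀ {k} → k ≢ 0ᶜ → recip (recip k) ≡ k
  recip-involutive {k} k≢0ᶜ = from-injective (trans (from-to _)
    (trans (⁻¹-cong (from-nonZero (recip-≢0ᶜ k≢0ᶜ)) (from-to _)) (⁻¹-involutive (from-nonZero k≢0ᶜ))))

  recip-neg : ∀ {k} → k ≢ 0ᶜ → recip (neg k) ≡ neg (recip k)
  recip-neg {k} k≢0ᶜ = to-cong (begin
    from (neg k) ⁻¹ ≈⟨ ⁻¹-cong (from-nonZero (neg-≢0ᶜ k≢0ᶜ)) (from-neg k) ⟩
    (- from k) ⁻¹   ≈⟨ -‿⁻¹ (from-nonZero k≢0ᶜ) ⟩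
    - from k ⁻¹     ≈⟨ -‿cong (from-to _) ⟨
    - from (recip k) ∎)

  x*x≈1⇒x≈1⊎x≈-1 : ∀ {x} → x * x ≈ 1# → x ≈ 1# ⊎ x ≈ - 1#
  x*x≈1⇒x≈1⊎x≈-1 {x} x²≈1 with x*y≈0⇒x≈0⊎y≈0 factored
    where
    factored : (x - 1#) * (x + 1#) ≈ 0#
    factored = begin
      (x - 1#) * (x + 1#) ≈⟨ solve 1 (λ x → (x :- con (+ 1)) :* (x :+ con (+ 1)) := x :* x :- con (+ 1)) refl x ⟩
      x * x - 1#          ≈⟨ +-congʳ x²≈1 ⟩
      1# - 1#             ≈⟨ -‿inverseʳ 1# ⟩
      0#                  ∎
  ... | inj₁ x-1≈0 = inj₁ (x-y≈0⇒x≈y x-1≈0)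
  ... | inj₂ x+1≈0 = inj₂ (trans (solve 1 (λ x → x := (x :+ con (+ 1)) :- con (+ 1)) refl x)
                               (trans (+-congʳ x+1≈0) (+-identityˡ (- 1#))))

  absRecip : Fin q → Fin q
  absRecip k = abs (recip k)

  absRecip-abs : ∀ {k} → k ≢ 0ᶜ → absRecip (abs k) ≡ absRecip k
  absRecip-abs {k} k≢0ᶜ with abs-cases k
  ... | inj₁ absk≡k    = ≡.cong absRecip absk≡k
  ... | inj₂ absk≡negk = ≡.trans (≡.cong absRecip absk≡negk)
    (≡.trans (≡.cong abs (recip-neg k≢0ᶜ)) (abs-neg (recip-≢0ᶜ k≢0ᶜ)))

  absRecip-Positive : ∀ {k} → Positive k → Positive (absRecip k)
  absRecip-Positive k+ = Positive-abs (recip-≢0ᶜ (Positive⇒≢0ᶜ k+))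

  absRecip-involutive : ∀ {k} → Positive k → absRecip (absRecip k) ≡ k
  absRecip-involutive {k} k+ = ≡.trans (absRecip-abs (recip-≢0ᶜ k≢0ᶜ))
    (≡.trans (≡.cong abs (recip-involutive k≢0ᶜ)) (abs-Positive k+))
    where k≢0ᶜ = Positive⇒≢0ᶜ k+

  1ᶜ≢0ᶜ : to 1# ≢ 0ᶜ
  1ᶜ≢0ᶜ = 1≉0 ∘ to-injective

  absRecip-±1 : absRecip (abs (to 1#)) ≡ abs (to 1#)
  absRecip-±1 = ≡.trans (absRecip-abs 1ᶜ≢0ᶜ)
    (≡.cong abs (to-cong (trans (⁻¹-cong (1≉0 ∘ trans (sym (from-to 1#))) (from-to 1#)) 1⁻¹≈1)))

  absRecip-fixed : ∀ {k} → Positive k → absRecip k ≡ k → k ≡ abs (to 1#) ⊎ from k * from k ≈ - 1#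
  absRecip-fixed {k} k+ fixed with abs-cases (recip k)
  ... | inj₂ ≡neg = inj₂ (begin
    x * x         ≈⟨ *-congˡ (≡.subst (λ l → from l ≈ - x ⁻¹) (≡.trans (≡.sym ≡neg) fixed)
                                      (trans (from-neg _) (-‿cong (from-to _)))) ⟩
    x * - x ⁻¹    ≈⟨ solve 2 (λ x y → x :* (:- y) := :- (x :* y)) refl x (x ⁻¹) ⟩
    - (x * x ⁻¹)  ≈⟨ -‿cong (⁻¹-inverseʳ (from-nonZero (Positive⇒≢0ᶜ k+))) ⟩
    - 1#          ∎)
    where x = from k
  ... | inj₁ ≡recip with x*x≈1⇒x≈1⊎x≈-1 x²≈1
    where
    x = from k
    x²≈1 : x * x ≈ 1#
    x²≈1 = begin
      x * x      ≈⟨ *-congˡ (≡.subst (λ l → from l ≈ x ⁻¹) (≡.trans (≡.sym ≡recip) fixed) (from-to _)) ⟩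
      x * x ⁻¹   ≈⟨ ⁻¹-inverseʳ (from-nonZero (Positive⇒≢0ᶜ k+)) ⟩
      1#         ∎
  ... | inj₁ x≈1  = inj₁ (≡.trans (≡.sym (abs-Positive k+)) (≡.cong abs (≡.trans (≡.sym (to-from k)) (to-cong x≈1))))
  ... | inj₂ x≈-1 = inj₁ (≡.trans (≡.sym (abs-Positive k+)) (≡.trans (≡.cong abs k≡neg1) (abs-neg 1ᶜ≢0ᶜ)))
    where
    k≡neg1 : k ≡ neg (to 1#)
    k≡neg1 = from-injective (trans x≈-1 (trans (-‿cong (sym (from-to 1#))) (sym (from-neg _))))

  -- Otherwise absRecip would be an involution of the half system, of even size m,
  -- whose only fixed point is the representative of ±1.
  √-1 : ∀ {m′} → m ≡ 2 ℕ.* m′ → ∃ λ i → i * i ≈ - 1#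
  √-1 {m′} m≡2m′ with Fin.any? (λ k → from k * from k ≈? - 1#)
  ... | yes (k , k²≈-1) = from k , k²≈-1
  ... | no ∄√-1 = ⊥-elim (ℕ.even≢odd m′ below (≡.trans (≡.sym m≡2m′) counted))
    where
    below : ℕ
    below = count (λ k → Positive? k ×-dec (toℕ k ℕ.<? toℕ (absRecip k)))

    only-±1 : ∀ {k} → Positive k × absRecip k ≡ k → k ≡ abs (to 1#)
    only-±1 {k} (k+ , fixed) = [ id , (λ k²≈-1 → ⊥-elim (∄√-1 (k , k²≈-1))) ] (absRecip-fixed k+ fixed)

    counted : m ≡ suc (2 ℕ.* below)
    counted = ≡.trans (≡.sym count-Positive)
      (≡.trans (count-involution Positive? absRecip absRecip-Positive absRecip-involutive)
               (≡.cong (ℕ._+ 2 ℕ.* below) (count-unique (λ k → Positive? k ×-dec (absRecip k Fin.≟ k))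
                  (Positive-abs 1ᶜ≢0ᶜ , absRecip-±1) only-±1)))

  -1∈C6 : ∀ {m′} → m ≡ 2 ℕ.* m′ → InC6 (- 1#)
  -1∈C6 {m′} m≡2m′ with √-1 {m′} m≡2m′
  ... | i , i²≈-1 = i , i≉0 , (begin
    - 1#                         ≈⟨ solve 0 (:- con (+ 1) := (:- con (+ 1)) :* ((:- con (+ 1)) :* (:- con (+ 1)))) refl ⟩
    - 1# * (- 1# * - 1#)         ≈⟨ *-cong i²≈-1 (*-cong i²≈-1 i²≈-1) ⟨
    i * i * (i * i * (i * i))    ≈⟨ solve 1 (λ i → i :* i :* (i :* i :* (i :* i)) := i :* (i :* (i :* (i :* (i :* i))))) refl i ⟩
    pow6 i                       ∎)
    where
    i≉0 : NonZero i
    i≉0 i≈0 = 1≉0 (begin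
      1#          ≈⟨ solve 0 (con (+ 1) := :- (:- con (+ 1))) refl ⟩
      - - 1#      ≈⟨ -‿cong i²≈-1 ⟨
      - (i * i)   ≈⟨ -‿cong (*-congʳ i≈0) ⟩
      - (0# * i)  ≈⟨ solve 1 (λ i → :- (con (+ 0) :* i) := con (+ 0)) refl i ⟩
      0#          ∎)

module SixthPowers {q : ℕ} (F : FiniteField q) where
  open FiniteField F hiding (zero)
  open Cyclotomy F
  open Inverse enum using (to; from; to-cong)
    renaming (strictlyInverseʳ to from-to; strictlyInverseˡ to to-from)
  open FieldProperties F
  open RingSolverℤ cring
  open import Relation.Binary.Reasoning.Setoid setoid

  choose : {P : Carrier → Set} → (∀ x → Dec (P x)) → Carrier
  choose P? with Fin.any? (P? ∘ from)
  ... | yes (k , _) = from k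
  ... | no _        = 0#

  choose-satisfies : ∀ {P : Carrier → Set} (P? : ∀ x → Dec (P x))
                   → (∀ {x y} → x ≈ y → P x → P y) → ∀ {x} → P x → P (choose P?)
  choose-satisfies P? resp {x} px with Fin.any? (P? ∘ from)
  ... | yes (_ , pk) = pk
  ... | no ∄k        = ⊥-elim (∄k (to x , resp (sym (from-to x)) px))

  monic-quadratic-roots : ∀ b {ρ u} → ρ * ρ + b * ρ + 1# ≈ 0# → u * u + b * u + 1# ≈ 0#
                        → u ≈ ρ ⊎ u ≈ - b - ρ
  monic-quadratic-roots b {ρ} {u} ρ-root u-root with x*y≈0⇒x≈0⊎y≈0 factored
    where
    factored : (u - ρ) * (u + ρ + b) ≈ 0#
    factored = begin
      (u - ρ) * (u + ρ + b)                         ≈⟨ solve 3 (λ b ρ u → (u :- ρ) :* (u :+ ρ :+ b)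
                                                         := (u :* u :+ b :* u :+ con (+ 1)) :- (ρ :* ρ :+ b :* ρ :+ con (+ 1))) refl b ρ u ⟩
      (u * u + b * u + 1#) - (ρ * ρ + b * ρ + 1#)   ≈⟨ x≈y⇒x-y≈0 (trans u-root (sym ρ-root)) ⟩
      0#                                            ∎
  ... | inj₁ u-ρ≈0   = inj₁ (x-y≈0⇒x≈y u-ρ≈0)
  ... | inj₂ u+ρ+b≈0 = inj₂ (begin
    u                     ≈⟨ solve 3 (λ b ρ u → u := (u :+ ρ :+ b) :+ (:- b :- ρ)) refl b ρ u ⟩
    (u + ρ + b) + (- b - ρ) ≈⟨ +-congʳ u+ρ+b≈0 ⟩
    0# + (- b - ρ)        ≈⟨ +-identityˡ _ ⟩
    - b - ρ               ∎)

  RootOf : Carrier → Carrier → Set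
  RootOf b u = u * u + b * u + 1# ≈ 0#

  someRoot : Carrier → Carrier
  someRoot b = choose (λ u → u * u + b * u + 1# ≈? 0#)

  RootOf-someRoot : ∀ {b u} → RootOf b u → u ≈ someRoot b ⊎ u ≈ - b - someRoot b
  RootOf-someRoot {b} u-root = monic-quadratic-roots b
    (choose-satisfies (λ u → u * u + b * u + 1# ≈? 0#) resp u-root) u-root
    where
    resp : ∀ {x y} → x ≈ y → RootOf b x → RootOf b y
    resp x≈y = trans (+-congʳ (+-cong (*-cong (sym x≈y) (sym x≈y)) (*-congˡ (sym x≈y))))

  -- u⁶ - 1 = (u - 1)(u + 1)(u² + u + 1)(u² - u + 1), and u² + b·u + 1 has the roots ρ and - b - ρ.
  sixthRootOfUnity : Fin 6 → Carrier
  sixthRootOfUnity 0F = 1#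
  sixthRootOfUnity 1F = - 1#
  sixthRootOfUnity 2F = someRoot 1#
  sixthRootOfUnity 3F = - 1# - someRoot 1#
  sixthRootOfUnity 4F = someRoot (- 1#)
  sixthRootOfUnity 5F = - - 1# - someRoot (- 1#)

  sixthRootOfUnity-complete : ∀ {u} → pow6 u ≈ 1# → ∃ λ j → u ≈ sixthRootOfUnity j
  sixthRootOfUnity-complete {u} u⁶≈1 with x*y≈0⇒x≈0⊎y≈0 factored
    where
    factored : (u - 1#) * ((u + 1#) * ((u * u + 1# * u + 1#) * (u * u + - 1# * u + 1#))) ≈ 0#
    factored = begin
      (u - 1#) * ((u + 1#) * ((u * u + 1# * u + 1#) * (u * u + - 1# * u + 1#)))
        ≈⟨ solve 1 (λ u → (u :- con (+ 1)) :* ((u :+ con (+ 1)) :* ((u :* u :+ con (+ 1) :* u :+ con (+ 1))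
                            :* (u :* u :+ (:- con (+ 1)) :* u :+ con (+ 1))))
                          := u :* (u :* (u :* (u :* (u :* u)))) :- con (+ 1)) refl u ⟩
      pow6 u - 1#
        ≈⟨ x≈y⇒x-y≈0 u⁶≈1 ⟩
      0# ∎
  ... | inj₁ u-1≈0 = 0F , x-y≈0⇒x≈y u-1≈0
  ... | inj₂ rest with x*y≈0⇒x≈0⊎y≈0 rest
  ... | inj₁ u+1≈0 = 1F , x-y≈0⇒x≈y (trans (+-congˡ (solve 0 (:- (:- con (+ 1)) := con (+ 1)) refl)) u+1≈0)
  ... | inj₂ quartic with x*y≈0⇒x≈0⊎y≈0 quartic
  ... | inj₁ ω₊-root = [ (2F ,_) , (3F ,_) ] (RootOf-someRoot ω₊-root)
  ... | inj₂ ω₋-root = [ (4F ,_) , (5F ,_) ] (RootOf-someRoot ω₋-root)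

  rootIndex : Carrier → Fin 6
  rootIndex u with Fin.any? (λ j → u ≈? sixthRootOfUnity j)
  ... | yes (j , _) = j
  ... | no _        = Fin.zero

  rootIndex-sound : ∀ {u} → pow6 u ≈ 1# → u ≈ sixthRootOfUnity (rootIndex u)
  rootIndex-sound {u} u⁶≈1 with Fin.any? (λ j → u ≈? sixthRootOfUnity j)
  ... | yes (_ , u≈) = u≈
  ... | no ∄j        = ⊥-elim (∄j (sixthRootOfUnity-complete u⁶≈1))

  rootIndex-injective : ∀ {u v} → pow6 u ≈ 1# → pow6 v ≈ 1# → rootIndex u ≡ rootIndex v → u ≈ v
  rootIndex-injective {u} {v} u⁶≈1 v⁶≈1 same = begin
    u                                ≈⟨ rootIndex-sound u⁶≈1 ⟩
    sixthRootOfUnity (rootIndex u)   ≡⟨ ≡.cong sixthRootOfUnity same ⟩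
    sixthRootOfUnity (rootIndex v)   ≈⟨ rootIndex-sound v⁶≈1 ⟨
    v                                ∎

  preimage : Carrier → Fin q → Carrier
  preimage r c = choose (λ z → to (r * pow6 z) Fin.≟ c)

  preimage-unitRoot : ∀ {r x c} → NonZero r → NonZero x → to (r * pow6 x) ≡ c
                    → NonZero (preimage r c) × pow6 (x * preimage r c ⁻¹) ≈ 1#
  preimage-unitRoot {r} {x} {c} r≉0 x≉0 rx⁶≡c = z≉0 , (begin
    pow6 (x * z ⁻¹)        ≈⟨ pow6-* x (z ⁻¹) ⟩
    pow6 x * pow6 (z ⁻¹)   ≈⟨ *-congˡ (pow6-⁻¹ z≉0) ⟨
    pow6 x * pow6 z ⁻¹     ≈⟨ *-congˡ (⁻¹-cong (pow6-nonZero z≉0) z⁶≈x⁶) ⟩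
    pow6 x * pow6 x ⁻¹     ≈⟨ ⁻¹-inverseʳ (pow6-nonZero x≉0) ⟩
    1#                     ∎)
    where
    z = preimage r c
    rz⁶≡c : to (r * pow6 z) ≡ c
    rz⁶≡c = choose-satisfies (λ z → to (r * pow6 z) Fin.≟ c)
      (λ y≈z ry⁶≡c → ≡.trans (to-cong (*-congˡ (pow6-cong (sym y≈z)))) ry⁶≡c) rx⁶≡c
    z⁶≈x⁶ : pow6 z ≈ pow6 x
    z⁶≈x⁶ = *-cancelˡ r≉0 (to-injective (≡.trans rz⁶≡c (≡.sym rx⁶≡c)))
    z≉0 : NonZero z
    z≉0 z≈0 = pow6-nonZero x≉0 (trans (sym z⁶≈x⁶) (trans (pow6-cong z≈0)
      (solve 0 (con (+ 0) :* (con (+ 0) :* (con (+ 0) :* (con (+ 0) :* (con (+ 0) :* con (+ 0))))) := con (+ 0)) refl)))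

  -- A nonzero x is determined by r·x⁶ and by which sixth root of unity x / z is, for the chosen preimage z.
  sixthPowerCode : Carrier → Carrier → Fin q × Fin 6
  sixthPowerCode r x = c , rootIndex (x * preimage r c ⁻¹)
    where c = to (r * pow6 x)

  sixthPowerCode-injective : ∀ {r x y} → NonZero r → NonZero x → NonZero y
                           → sixthPowerCode r x ≡ sixthPowerCode r y → x ≈ y
  sixthPowerCode-injective {r} {x} {y} r≉0 x≉0 y≉0 same = *-cancelʳ (⁻¹-nonZero z≉0)
    (rootIndex-injective x/z-root y/z-root
      (≡.trans (proj₂ (,-injective same))
               (≡.cong (λ c → rootIndex (y * preimage r c ⁻¹)) (≡.sym c≡))))
    where
    c≡ = proj₁ (,-injective same)
    z≉0 = proj₁ (preimage-unitRoot r≉0 x≉0 ≡.refl)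
    x/z-root = proj₂ (preimage-unitRoot r≉0 x≉0 ≡.refl)
    y/z-root = proj₂ (preimage-unitRoot r≉0 y≉0 (≡.sym c≡))

  sixthPowerCode-value : ∀ {r r′ x y} → sixthPowerCode r x ≡ sixthPowerCode r′ y → r * pow6 x ≈ r′ * pow6 y
  sixthPowerCode-value same = to-injective (proj₁ (,-injective same))

  -- Pigeonhole for (i , x) ↦ (r i · x⁶ , rootIndex …): as the code determines a nonzero x,
  -- two arguments with the same code must have different i.
  C6-pigeonhole : 7 ℕ.< q → (r : Fin 7 → Carrier) → (∀ i → NonZero (r i))
                → ∃₂ λ i j → i ≢ j × SameCoset (r i) (r j)
  C6-pigeonhole 7<q r r≉0 = collision (Fin.pigeonhole bound (Inverse.from codes ∘ Φ ∘ Inverse.to pairs))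
    where
    classify : Fin 7 → (k : Fin q) → Dec (from k ≈ 0#) → Fin 7 ⊎ (Fin q × Fin 6)
    classify i k (yes _) = inj₁ i
    classify i k (no _)  = inj₂ (sixthPowerCode (r i) (from k))

    Φ : Fin 7 × Fin q → Fin 7 ⊎ (Fin q × Fin 6)
    Φ (i , k) = classify i k (from k ≈? 0#)

    pairs : Fin (7 ℕ.* q) ↔ (Fin 7 × Fin q)
    pairs = Fin.*↔×

    codes : Fin (7 ℕ.+ q ℕ.* 6) ↔ (Fin 7 ⊎ (Fin q × Fin 6))
    codes = ↔-trans Fin.+↔⊎ (↔-refl ⊎-↔ Fin.*↔×)

    bound : 7 ℕ.+ q ℕ.* 6 ℕ.< 7 ℕ.* q
    bound = ≡.subst (7 ℕ.+ q ℕ.* 6 ℕ.<_) (≡.cong (q ℕ.+_) (ℕ.*-comm q 6)) (ℕ.+-monoˡ-< (q ℕ.* 6) 7<q)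

    collide : ∀ i k i′ k′ d d′ → (i , k) ≢ (i′ , k′) → classify i k d ≡ classify i′ k′ d′
            → ∃₂ λ i j → i ≢ j × SameCoset (r i) (r j)
    collide i k i′ k′ (yes k≈0) (yes k′≈0) p≢p′ ≡.refl =
      ⊥-elim (p≢p′ (≡.cong (i ,_) (from-injective (trans k≈0 (sym k′≈0)))))
    collide i k i′ k′ (no k≉0) (no k′≉0) p≢p′ same = compare (i Fin.≟ i′)
      where
      r⁶-same : sixthPowerCode (r i) (from k) ≡ sixthPowerCode (r i′) (from k′)
      r⁶-same = inj₂-injective same
      compare : Dec (i ≡ i′) → ∃₂ λ i j → i ≢ j × SameCoset (r i) (r j)
      compare (yes ≡.refl) = ⊥-elim (p≢p′ (≡.cong (i ,_) (from-injective
        (sixthPowerCode-injective (r≉0 i) k≉0 k′≉0 r⁶-same))))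
      compare (no i≢i′) = i , i′ , i≢i′ , SameCoset-scaled (InC6-pow6 k≉0) (InC6-pow6 k′≉0)
        (trans (*-comm _ _) (trans (sixthPowerCode-value r⁶-same) (*-comm _ _)))

    collision : (∃₂ λ ι ι′ → ι Fin.< ι′ × Inverse.from codes (Φ (Inverse.to pairs ι)) ≡ Inverse.from codes (Φ (Inverse.to pairs ι′)))
              → ∃₂ λ i j → i ≢ j × SameCoset (r i) (r j)
    collision (ι , ι′ , ι<ι′ , same) =
      collide (proj₁ p) (proj₂ p) (proj₁ p′) (proj₂ p′) (from (proj₂ p) ≈? 0#) (from (proj₂ p′) ≈? 0#)
        (Fin.<⇒≢ ι<ι′ ∘ Injection.injective (↔⇒↣ pairs))
        (Injection.injective (↔⇒↣ (↔-sym codes)) same)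
      where
      p = Inverse.to pairs ι
      p′ = Inverse.to pairs ι′

  six-representatives-cover : 7 ℕ.< q → (r : Fin 6 → Carrier) → (∀ e → NonZero (r e))
    → (∀ {e e′} → e ≢ e′ → ¬ SameCoset (r e) (r e′))
    → ∀ {δ} → NonZero δ → ∃ λ e → SameCoset δ (r e)
  six-representatives-cover 7<q r r≉0 r-distinct {δ} δ≉0 = pick (C6-pigeonhole 7<q δ∷r δ∷r≉0)
    where
    δ∷r : Fin 7 → Carrier
    δ∷r Fin.zero    = δ
    δ∷r (Fin.suc e) = r e

    δ∷r≉0 : ∀ i → NonZero (δ∷r i)
    δ∷r≉0 Fin.zero    = δ≉0
    δ∷r≉0 (Fin.suc e) = r≉0 e

    pick : (∃₂ λ i j → i ≢ j × SameCoset (δ∷r i) (δ∷r j)) → ∃ λ e → SameCoset δ (r e)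
    pick (Fin.zero  , Fin.zero   , 0≢0 , _)      = ⊥-elim (0≢0 ≡.refl)
    pick (Fin.zero  , Fin.suc e  , _ , δ∼re)     = e , δ∼re
    pick (Fin.suc e , Fin.zero   , _ , re∼δ)     = e , SameCoset-sym re∼δ
    pick (Fin.suc e , Fin.suc e′ , e≢e′ , re∼re′) = ⊥-elim (r-distinct (e≢e′ ∘ ≡.cong Fin.suc) re∼re′)

module BaseBlocks where
  open import Data.List.Membership.DecPropositional (Fin._≟_ {16}) using (_∈?_)

  -- Z₂ × Z₂, a pair of bits (x, y) coded as 2x + y.
  infixl 6 _⊕_
  _⊕_ : Fin 4 → Fin 4 → Fin 4
  0F ⊕ h  = h
  1F ⊕ 0F = 1F
  1F ⊕ 1F = 0F
  1F ⊕ 2F = 3F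
  1F ⊕ 3F = 2F
  2F ⊕ 0F = 2F
  2F ⊕ 1F = 3F
  2F ⊕ 2F = 0F
  2F ⊕ 3F = 1F
  3F ⊕ 0F = 3F
  3F ⊕ 1F = 2F
  3F ⊕ 2F = 1F
  3F ⊕ 3F = 0F

  ⊕-comm : ∀ g h → g ⊕ h ≡ h ⊕ g
  ⊕-comm = toWitness {a? = Fin.all? λ g → Fin.all? λ h → g ⊕ h Fin.≟ h ⊕ g} tt

  ⊕-assoc : ∀ f g h → f ⊕ g ⊕ h ≡ f ⊕ (g ⊕ h)
  ⊕-assoc = toWitness {a? = Fin.all? λ f → Fin.all? λ g → Fin.all? λ h → f ⊕ g ⊕ h Fin.≟ f ⊕ (g ⊕ h)} tt

  ⊕-self : ∀ g → g ⊕ g ≡ 0F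
  ⊕-self = toWitness {a? = Fin.all? λ g → g ⊕ g Fin.≟ 0F} tt

  ⊕-difference : ∀ f g h → (f ⊕ h) ⊕ (g ⊕ h) ≡ f ⊕ g
  ⊕-difference = toWitness {a? = Fin.all? λ f → Fin.all? λ g → Fin.all? λ h → (f ⊕ h) ⊕ (g ⊕ h) Fin.≟ f ⊕ g} tt

  ⊕-transport : ∀ f g h k → f ⊕ g ≡ h ⊕ k → g ⊕ (h ⊕ f) ≡ k
  ⊕-transport = toWitness {a? = Fin.all? λ f → Fin.all? λ g → Fin.all? λ h → Fin.all? λ k →
    f ⊕ g Fin.≟ h ⊕ k →-dec g ⊕ (h ⊕ f) Fin.≟ k} tt

  ⊕-loop : ∀ f g h → f ⊕ (g ⊕ h) ≡ h → f ≡ g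
  ⊕-loop = toWitness {a? = Fin.all? λ f → Fin.all? λ g → Fin.all? λ h → f ⊕ (g ⊕ h) Fin.≟ h →-dec f Fin.≟ g} tt

  ⊕-cancelˡ : ∀ f g → f ⊕ (f ⊕ g) ≡ g
  ⊕-cancelˡ f g = ≡.trans (≡.sym (⊕-assoc f f g)) (≡.cong (_⊕ g) (⊕-self f))

  ⊕-injectiveˡ : ∀ f {g h} → f ⊕ g ≡ f ⊕ h → g ≡ h
  ⊕-injectiveˡ f {g} {h} fg≡fh = ≡.trans (≡.sym (⊕-cancelˡ f g)) (≡.trans (≡.cong (f ⊕_) fg≡fh) (⊕-cancelˡ f h))

  ⊕-injectiveʳ : ∀ f {g h} → g ⊕ f ≡ h ⊕ f → g ≡ h
  ⊕-injectiveʳ f {g} {h} gf≡hf = ⊕-injectiveˡ f (≡.trans (⊕-comm f g) (≡.trans gf≡hf (⊕-comm h f)))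

  -- The Z₂ × Z₂ coordinate of the base point aᵢ₊₁: it is g for the aᵢ₊₁ listed in U_g.
  label : Fin 16 → Fin 4
  label = lookup (0F ∷ 0F ∷ 1F ∷ 2F ∷ 0F ∷ 0F ∷ 1F ∷ 2F ∷ 0F ∷ 3F ∷ 3F ∷ 3F ∷ 1F ∷ 2F ∷ 3F ∷ 3F ∷ [])

  -- The base blocks are {a₁,…,a₄}, {a₅,…,a₈}, {a₉,…,a₁₂}, {a₁₃,…,a₁₆}.
  index : Fin 4 → Fin 4 → Fin 16
  index j p = Fin.combine j p

  blockOf : Fin 16 → Fin 4
  blockOf i = proj₁ (Fin.remQuot {4} 4 i)

  placeOf : Fin 16 → Fin 4
  placeOf i = proj₂ (Fin.remQuot {4} 4 i)

  index-blockOf : ∀ i → index (blockOf i) (placeOf i) ≡ i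
  index-blockOf i = Fin.combine-remQuot {4} 4 i

  index-injective : ∀ {j p j′ p′} → index j p ≡ index j′ p′ → j ≡ j′ × p ≡ p′
  index-injective {j} {p} {j′} {p′} = Fin.combine-injective j p j′ p′

  -- Δ-pairs d lists the index pairs (i , k) of the entries aᵢ₊₁ - aₖ₊₁ of the list Δ_d.
  Δ-pairs : Fin 4 → Fin 6 → Fin 16 × Fin 16
  Δ-pairs 0F = lookup ((# 0 , # 1) ∷ (# 4 , # 5) ∷ (# 9 , # 10) ∷ (# 9 , # 11) ∷ (# 10 , # 11) ∷ (# 14 , # 15) ∷ [])
  Δ-pairs 1F = lookup ((# 0 , # 2) ∷ (# 1 , # 2) ∷ (# 4 , # 6) ∷ (# 5 , # 6) ∷ (# 13 , # 14) ∷ (# 13 , # 15) ∷ [])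
  Δ-pairs 2F = lookup ((# 0 , # 3) ∷ (# 1 , # 3) ∷ (# 4 , # 7) ∷ (# 5 , # 7) ∷ (# 12 , # 14) ∷ (# 12 , # 15) ∷ [])
  Δ-pairs 3F = lookup ((# 2 , # 3) ∷ (# 6 , # 7) ∷ (# 8 , # 9) ∷ (# 8 , # 10) ∷ (# 8 , # 11) ∷ (# 12 , # 13) ∷ [])

  U-indices : Fin 4 → List (Fin 16)
  U-indices 0F = # 0 ∷ # 1 ∷ # 4 ∷ # 5 ∷ # 8 ∷ []
  U-indices 1F = # 2 ∷ # 6 ∷ # 12 ∷ []
  U-indices 2F = # 3 ∷ # 7 ∷ # 13 ∷ []
  U-indices 3F = # 9 ∷ # 10 ∷ # 11 ∷ # 14 ∷ # 15 ∷ []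

  orient : Bool → Fin 16 → Fin 16 → Fin 16 × Fin 16
  orient true  i k = i , k
  orient false i k = k , i

  private
    _≟ᵖ_ : (x y : Fin 16 × Fin 16) → Dec (x ≡ y)
    _≟ᵖ_ = ≡-dec Fin._≟_ Fin._≟_

    in-Δ-pairs : ∀ j p p′ → p ≡ p′ ⊎ ∃ λ e → let d = label (index j p) ⊕ label (index j p′) in
                 Δ-pairs d e ≡ (index j p , index j p′) ⊎ Δ-pairs d e ≡ (index j p′ , index j p)
    in-Δ-pairs = toWitness {a? = Fin.all? λ j → Fin.all? λ p → Fin.all? λ p′ → p Fin.≟ p′ ⊎-dec Fin.any? λ e →
      let d = label (index j p) ⊕ label (index j p′) in
      Δ-pairs d e ≟ᵖ (index j p , index j p′) ⊎-dec Δ-pairs d e ≟ᵖ (index j p′ , index j p)} tt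

  Δ-pairs-complete : ∀ j {p p′} → p ≢ p′ →
    ∃₂ λ e b → Δ-pairs (label (index j p) ⊕ label (index j p′)) e ≡ orient b (index j p) (index j p′)
  Δ-pairs-complete j {p} {p′} p≢p′ with in-Δ-pairs j p p′
  ... | inj₁ p≡p′           = ⊥-elim (p≢p′ p≡p′)
  ... | inj₂ (e , inj₁ eq) = e , true , eq
  ... | inj₂ (e , inj₂ eq) = e , false , eq

  Δ-pairs-sound : ∀ d e → let (i , k) = Δ-pairs d e in blockOf i ≡ blockOf k × label i ⊕ label k ≡ d
  Δ-pairs-sound = toWitness {a? = Fin.all? λ d → Fin.all? λ e → let (i , k) = Δ-pairs d e in
    blockOf i Fin.≟ blockOf k ×-dec label i ⊕ label k Fin.≟ d} tt

  U-indices-label : ∀ i → i ∈ U-indices (label i)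
  U-indices-label = toWitness {a? = Fin.all? λ i → i ∈? U-indices (label i)} tt

open BaseBlocks

module Construction {n : ℕ} (1≤n : 1 ℕ.≤ n) (F : FiniteField (12 ℕ.* n ℕ.+ 1))
                    (a : Fin 16 → FiniteField.Carrier F) (hyp : Cyclotomy.Hypotheses F a) where
  open FiniteField F hiding (zero)
  open Cyclotomy F
  open Inverse enum using (to; from; to-cong)
    renaming (strictlyInverseʳ to from-to; strictlyInverseˡ to to-from)
  open FieldProperties F
  open RingSolverℤ cring
  open import Relation.Binary.Reasoning.Setoid setoid

  q : ℕ
  q = 12 ℕ.* n ℕ.+ 1

  q≡1+4[3n] : q ≡ suc (2 ℕ.* (2 ℕ.* (3 ℕ.* n)))
  q≡1+4[3n] = ≡.trans (ℕ.+-comm (12 ℕ.* n) 1) (≡.cong suc (≡.trans (ℕ.*-assoc 4 3 n) (ℕ.*-assoc 2 2 (3 ℕ.* n))))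

  open OddOrder {m = 2 ℕ.* (3 ℕ.* n)} F q≡1+4[3n] hiding (-1∈C6)

  -1∈C6 : InC6 (- 1#)
  -1∈C6 = OddOrder.-1∈C6 {m = 2 ℕ.* (3 ℕ.* n)} F q≡1+4[3n] {3 ℕ.* n} ≡.refl

  7<q : 7 ℕ.< q
  7<q = ℕ.≤-trans (ℕ.m≤m+n 8 4) (ℕ.≤-trans (ℕ.*-monoʳ-≤ 12 1≤n) (ℕ.m≤m+n (12 ℕ.* n) 1))

  Δ : Fin 4 → Fin 6 → Carrier
  Δ d e = a (proj₁ (Δ-pairs d e)) - a (proj₂ (Δ-pairs d e))

  Δ-system : ∀ d → CompleteSystem (map (Δ d) (allFin 6))
  Δ-system 0F = proj₁ (proj₁ (proj₂ hyp))
  Δ-system 1F = proj₁ (proj₂ (proj₁ (proj₂ hyp)))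
  Δ-system 2F = proj₁ (proj₂ (proj₂ (proj₁ (proj₂ hyp))))
  Δ-system 3F = proj₂ (proj₂ (proj₂ (proj₁ (proj₂ hyp))))

  U-system : ∀ g → PartialSystemNonC6 (map a (U-indices g))
  U-system 0F = proj₁ (proj₂ (proj₂ hyp))
  U-system 1F = proj₁ (proj₂ (proj₂ (proj₂ hyp)))
  U-system 2F = proj₁ (proj₂ (proj₂ (proj₂ (proj₂ hyp))))
  U-system 3F = proj₂ (proj₂ (proj₂ (proj₂ (proj₂ hyp))))

  ¬SameCoset-sym : ∀ {x y} → ¬ SameCoset x y → ¬ SameCoset y x
  ¬SameCoset-sym x≁y = x≁y ∘ SameCoset-sym

  Δ-nonZero : ∀ d e → NonZero (Δ d e)
  Δ-nonZero d e = All-map-∈ {f = Δ d} (proj₁ (proj₂ (Δ-system d))) (∈-allFin e)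

  Δ-distinct : ∀ d {e e′} → e ≢ e′ → ¬ SameCoset (Δ d e) (Δ d e′)
  Δ-distinct d e≢e′ = AllPairs-map-∈ {f = Δ d} ¬SameCoset-sym (proj₂ (proj₂ (Δ-system d))) (∈-allFin _) (∈-allFin _) e≢e′

  Δ-covers : ∀ d {δ} → NonZero δ → ∃ λ e → SameCoset δ (Δ d e)
  Δ-covers d δ≉0 = SixthPowers.six-representatives-cover F 7<q (Δ d) (Δ-nonZero d) (Δ-distinct d) δ≉0

  a-notC6 : ∀ i → ¬ InC6 (a i)
  a-notC6 i = proj₂ (All-map-∈ {f = a} (proj₁ (U-system (label i))) (U-indices-label i))

  a-distinct : ∀ {i i′} → label i ≡ label i′ → i ≢ i′ → ¬ SameCoset (a i) (a i′)
  a-distinct {i} {i′} same i≢i′ = AllPairs-map-∈ {f = a} ¬SameCoset-sym (proj₂ (U-system (label i)))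
    (U-indices-label i) (≡.subst (λ g → i′ ∈ U-indices g) (≡.sym same) (U-indices-label i′)) i≢i′

  a-nonZero : ∀ i → NonZero (a i)
  a-nonZero = proj₁ hyp

  ¬InC6-*-a : ∀ {c} i → InC6 c → ¬ InC6 (c * a i)
  ¬InC6-*-a {c} i c∈C6 ca∈C6 = a-notC6 i
    (InC6-resp (sym (c*x≈y⇒x≈c⁻¹*y (InC6-nonZero c∈C6) refl)) (InC6-* (InC6-⁻¹ c∈C6) ca∈C6))

  InC6-*-a-injective : ∀ {c c′ i i′} → InC6 c → InC6 c′ → label i ≡ label i′ → c * a i ≈ c′ * a i′ → i ≡ i′
  InC6-*-a-injective {i = i} {i′} c∈C6 c′∈C6 same-label ca≈c′a′ with i Fin.≟ i′
  ... | yes i≡i′ = i≡i′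
  ... | no i≢i′  = ⊥-elim (a-distinct same-label i≢i′ (SameCoset-scaled c∈C6 c′∈C6 ca≈c′a′))

  sign : Bool → Carrier
  sign true  = 1#
  sign false = - 1#

  sign-C6 : ∀ b → InC6 (sign b)
  sign-C6 true  = InC6-1
  sign-C6 false = -1∈C6

  orient-difference : ∀ b {d e i k} → Δ-pairs d e ≡ orient b i k → a i - a k ≈ sign b * Δ d e
  orient-difference true  {d} {e} {i} {k} Δde≡ik = begin
    a i - a k      ≡⟨ ≡.cong (λ (i , k) → a i - a k) Δde≡ik ⟨
    Δ d e          ≈⟨ *-identityˡ (Δ d e) ⟨
    1# * Δ d e     ∎
  orient-difference false {d} {e} {i} {k} Δde≡ki = begin
    a i - a k          ≈⟨ solve 2 (λ x y → x :- y := (:- con (+ 1)) :* (y :- x)) refl (a i) (a k) ⟩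
    - 1# * (a k - a i) ≡⟨ ≡.cong (λ (k , i) → - 1# * (a k - a i)) Δde≡ki ⟨
    - 1# * Δ d e       ∎

  orient-injective : ∀ b {i k i′ k′} → orient b i k ≡ orient b i′ k′ → i ≡ i′
  orient-injective true  = ≡.cong proj₁
  orient-injective false = ≡.cong proj₂

  BaseDifference : Fin 4 → Fin 16 → Fin 16 → Set
  BaseDifference d i k = ∃₂ λ e b → Δ-pairs d e ≡ orient b i k × a i - a k ≈ sign b * Δ d e

  base-difference : ∀ j {p p′} → p ≢ p′
    → BaseDifference (label (index j p) ⊕ label (index j p′)) (index j p) (index j p′)
  base-difference j {p} {p′} p≢p′ =
    extend {label (index j p) ⊕ label (index j p′)} {index j p} {index j p′} (Δ-pairs-complete j p≢p′)
    where
    extend : ∀ {d i k} → (∃₂ λ e b → Δ-pairs d e ≡ orient b i k) → BaseDifference d i k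
    extend {d} (e , b , Δde≡) = e , b , Δde≡ , orient-difference b {d} Δde≡

  base-difference-nonZero : ∀ j {p p′} → p ≢ p′ → NonZero (a (index j p) - a (index j p′))
  base-difference-nonZero j {p} {p′} p≢p′ =
    nonZero {label (index j p) ⊕ label (index j p′)} {index j p} {index j p′} (base-difference j p≢p′)
    where
    nonZero : ∀ {d i k} → BaseDifference d i k → NonZero (a i - a k)
    nonZero {d} (e , b , _ , diff) = *-nonZero (InC6-nonZero (sign-C6 b)) (Δ-nonZero d e) ∘ trans (sym diff)

  -- One multiplier from each class {s, -s} ⊆ C⁶, given by its code.
  Multiplier : Fin q → Set
  Multiplier s = InC6 (from s) × Positive s

  Multiplier? : ∀ s → Dec (Multiplier s)
  Multiplier? s = InC6? (from s) ×-dec Positive? s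

  Multiplier-rigid : ∀ {s s′} b b′ → Multiplier s → Multiplier s′
                   → from s * sign b ≈ from s′ * sign b′ → s ≡ s′ × b ≡ b′
  Multiplier-rigid true true _ _ s≈s′ =
    from-injective (*-cancelʳ 1≉0 s≈s′) , ≡.refl
  Multiplier-rigid false false _ _ s≈s′ =
    from-injective (*-cancelʳ (InC6-nonZero -1∈C6) s≈s′) , ≡.refl
  Multiplier-rigid {s} {s′} true false (_ , s+) (_ , s′+) s≈-s′ = ⊥-elim (Positive-≉-neg s+ s′+ (begin
    from s           ≈⟨ *-identityʳ (from s) ⟨
    from s * 1#      ≈⟨ s≈-s′ ⟩
    from s′ * - 1#   ≈⟨ solve 1 (λ x → x :* (:- con (+ 1)) := :- x) refl (from s′) ⟩
    - from s′        ∎))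
  Multiplier-rigid {s} {s′} false true (_ , s+) (_ , s′+) -s≈s′ = ⊥-elim (Positive-≉-neg s′+ s+ (begin
    from s′          ≈⟨ *-identityʳ (from s′) ⟨
    from s′ * 1#     ≈⟨ -s≈s′ ⟨
    from s * - 1#    ≈⟨ solve 1 (λ x → x :* (:- con (+ 1)) := :- x) refl (from s) ⟩
    - from s         ∎))

  v : ℕ
  v = 4 ℕ.* q

  -- pt x g is the point (x, g) of F_q × Z₂², coded in Fin (4q).
  abstract
    pt : Carrier → Fin 4 → Fin v
    pt x g = Fin.combine g (to x)

    pt-cong : ∀ {x y} g → x ≈ y → pt x g ≡ pt y g
    pt-cong g x≈y = ≡.cong (Fin.combine g) (to-cong x≈y)

    pt-injective : ∀ {x y g h} → pt x g ≡ pt y h → x ≈ y × g ≡ h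
    pt-injective {x} {y} {g} {h} same with Fin.combine-injective g (to x) h (to y) same
    ... | g≡h , tx≡ty = to-injective tx≡ty , g≡h

    pt-surjective : ∀ X → ∃₂ λ x g → X ≡ pt x g
    pt-surjective X = from k , g , ≡.trans (≡.sym (Fin.combine-remQuot {4} q X))
                                         (≡.cong (Fin.combine g) (≡.sym (to-from k)))
      where
      g : Fin 4
      g = proj₁ (Fin.remQuot {4} q X)
      k : Fin q
      k = proj₂ (Fin.remQuot {4} q X)

  -- fibre t is {t} × Z₂² with nested point (t + 1, 0); developed j s t g is s·Bⱼ + (t, g),
  -- Bⱼ = {(aᵢ, label i) : i in the j-th base block}, with nested point (t, g).
  -- Field elements are given by their codes, so that parameters have decidable equality.
  data Param : Set where
    fibre     : Fin q → Param
    developed : Fin 4 → Fin q → Fin q → Fin 4 → Param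

  Valid : Param → Set
  Valid (fibre _)             = ⊤
  Valid (developed _ s _ _)   = Multiplier s

  Valid? : ∀ π → Dec (Valid π)
  Valid? (fibre _)           = yes tt
  Valid? (developed _ s _ _) = Multiplier? s

  coord : Fin q → Fin q → Fin 16 → Carrier
  coord s t i = from s * a i + from t

  point : Param → Fin 4 → Fin v
  point (fibre t)           p = pt (from t) p
  point (developed j s t g) p = pt (coord s t (index j p)) (label (index j p) ⊕ g)

  nested : Param → Fin v
  nested (fibre t)           = pt (from t + 1#) 0F
  nested (developed j s t g) = pt (from t) g

  coord-difference : ∀ s t i k → coord s t i - coord s t k ≈ from s * (a i - a k)
  coord-difference s t i k = solve 4 (λ s x y t → (s :* x :+ t) :- (s :* y :+ t) := s :* (x :- y))
                               refl (from s) (a i) (a k) (from t)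

  coord-translation : ∀ s t i → coord s t i - from t ≈ from s * a i
  coord-translation s t i = solve 2 (λ u t → (u :+ t) :- t := u) refl (from s * a i) (from t)

  point-injective : ∀ {π} → Valid π → ∀ {p p′} → p ≢ p′ → point π p ≢ point π p′
  point-injective {fibre t} _ p≢p′ same = p≢p′ (proj₂ (pt-injective same))
  point-injective {developed j s t g} (s∈C6 , _) {p} {p′} p≢p′ same =
    *-nonZero (InC6-nonZero s∈C6) (base-difference-nonZero j p≢p′)
      (trans (sym (coord-difference s t (index j p) (index j p′))) (x≈y⇒x-y≈0 (proj₁ (pt-injective same))))

  nested-∉ : ∀ {π} → Valid π → ∀ p → nested π ≢ point π p
  nested-∉ {fibre t} _ p same = 1≉0 (+-cancelˡ (from t) 1# 0#
    (trans (proj₁ (pt-injective same)) (sym (+-identityʳ (from t)))))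
  nested-∉ {developed j s t g} (s∈C6 , _) p same =
    *-nonZero (InC6-nonZero s∈C6) (a-nonZero (index j p))
      (trans (sym (coord-translation s t (index j p))) (x≈y⇒x-y≈0 (sym (proj₁ (pt-injective same)))))

  point-developed : ∀ j p {s t g′ i x g} → index j p ≡ i → coord s t i ≈ x → label i ⊕ g′ ≡ g
                  → point (developed j s t g′) p ≡ pt x g
  point-developed j p ≡.refl x≈ ≡.refl = pt-cong _ x≈

  developed-determined : ∀ {j s t g j′ t′ g′ p p′} → index j p ≡ index j′ p′
    → point (developed j s t g) p ≡ point (developed j′ s t′ g′) p′
    → developed j s t g ≡ developed j′ s t′ g′
  developed-determined {j} {s} {t} {g} {j′} {p = p} {p′} same-index same-point
    with index-injective {j} {p} {j′} {p′} same-index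
  ... | ≡.refl , ≡.refl = ≡.cong₂ (developed j s)
    (from-injective (+-cancelˡ (from s * a (index j p)) _ _ (proj₁ (pt-injective same-point))))
    (⊕-injectiveˡ (label (index j p)) (proj₂ (pt-injective same-point)))

  multiplier-for : ∀ {c} → InC6 c → ∃ λ s → Multiplier s × (from s ≈ c ⊎ from s ≈ - c)
  multiplier-for {c} c∈C6 = s , (±c∈C6 ±c , Positive-abs c≢0ᶜ) , ±c
    where
    s = abs (to c)

    c≢0ᶜ : to c ≢ 0ᶜ
    c≢0ᶜ = InC6-nonZero c∈C6 ∘ to-injective

    sign-of : s ≡ to c ⊎ s ≡ neg (to c) → from s ≈ c ⊎ from s ≈ - c
    sign-of (inj₁ s≡c)  = inj₁ (trans (≡.subst (λ k → from s ≈ from k) s≡c refl) (from-to c))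
    sign-of (inj₂ s≡-c) = inj₂ (trans (≡.subst (λ k → from s ≈ from k) s≡-c refl)
                                      (trans (from-neg (to c)) (-‿cong (from-to c))))
    ±c = sign-of (abs-cases (to c))

    ±c∈C6 : from s ≈ c ⊎ from s ≈ - c → InC6 (from s)
    ±c∈C6 (inj₁ s≈c)  = InC6-resp (sym s≈c) c∈C6
    ±c∈C6 (inj₂ s≈-c) = InC6-resp (trans (solve 1 (λ c → (:- con (+ 1)) :* c := :- c) refl c) (sym s≈-c))
                                  (InC6-* -1∈C6 c∈C6)

  Covers : Param → Fin v → Fin v → Set
  Covers π X Y = (∃ λ p → X ≡ point π p) × (∃ λ p → Y ≡ point π p)

  developed-through : ∀ {x y g h i k s} → Multiplier s → blockOf i ≡ blockOf k → label i ⊕ label k ≡ g ⊕ h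
    → x - y ≈ from s * (a i - a k) → ∃ λ π → Valid π × Covers π (pt x g) (pt y h)
  developed-through {x} {y} {g} {h} {i} {k} {s} s∈S same-block labels x-y≈ =
    developed (blockOf i) s t (g ⊕ label i) , s∈S ,
    (placeOf i , ≡.sym (point-developed (blockOf i) (placeOf i) (index-blockOf i) x≈
                         (⊕-transport (label i) (label i) g g (≡.trans (⊕-self (label i)) (≡.sym (⊕-self g)))))) ,
    (placeOf k , ≡.sym (point-developed (blockOf i) (placeOf k) k-index y≈ (⊕-transport (label i) (label k) g h labels)))
    where
    t = to (x - from s * a i)
    k-index : index (blockOf i) (placeOf k) ≡ k
    k-index = ≡.trans (≡.cong (λ j → index j (placeOf k)) same-block) (index-blockOf k)
    x≈ : coord s t i ≈ x
    x≈ = trans (+-congˡ (from-to _)) (solve 2 (λ u x → u :+ (x :- u) := x) refl (from s * a i) x)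
    y≈ : coord s t k ≈ y
    y≈ = begin
      from s * a k + from t              ≈⟨ +-congˡ (from-to _) ⟩
      from s * a k + (x - from s * a i)  ≈⟨ solve 4 (λ s p r x → s :* r :+ (x :- s :* p) := x :- s :* (p :- r))
                                              refl (from s) (a i) (a k) x ⟩
      x - from s * (a i - a k)           ≈⟨ +-congˡ (-‿cong x-y≈) ⟨
      x - (x - y)                        ≈⟨ solve 2 (λ x y → x :- (x :- y) := y) refl x y ⟩
      y                                  ∎

  pair-covered : ∀ {X Y} → X ≢ Y → ∃ λ π → Valid π × Covers π X Y
  pair-covered {X} {Y} X≢Y with pt-surjective X | pt-surjective Y
  ... | x , g , ≡.refl | y , h , ≡.refl = by-cases (x ≈? y)
    where
    by-cases : Dec (x ≈ y) → ∃ λ π → Valid π × Covers π (pt x g) (pt y h)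
    by-cases (yes x≈y) = fibre (to x) , tt , (g , pt-cong g (sym (from-to x))) , (h , pt-cong h (trans (sym x≈y) (sym (from-to x))))
    by-cases (no x≉y) = through (Δ-covers (g ⊕ h) (x≉y ∘ x-y≈0⇒x≈y))
      where
      through : (∃ λ e → SameCoset (x - y) (Δ (g ⊕ h) e)) → ∃ λ π → Valid π × Covers π (pt x g) (pt y h)
      through (e , c , c∈C6 , x-y≈cΔ) = oriented (multiplier-for c∈C6)
        where
        i = proj₁ (Δ-pairs (g ⊕ h) e)
        k = proj₂ (Δ-pairs (g ⊕ h) e)
        same-block = proj₁ (Δ-pairs-sound (g ⊕ h) e)
        labels = proj₂ (Δ-pairs-sound (g ⊕ h) e)
        oriented : (∃ λ s → Multiplier s × (from s ≈ c ⊎ from s ≈ - c)) → ∃ λ π → Valid π × Covers π (pt x g) (pt y h)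
        oriented (s , s∈S , inj₁ s≈c)  = developed-through s∈S same-block labels
          (trans x-y≈cΔ (*-congʳ (sym s≈c)))
        oriented (s , s∈S , inj₂ s≈-c) = developed-through s∈S (≡.sym same-block) (≡.trans (⊕-comm (label k) (label i)) labels)
          (trans x-y≈cΔ (trans (solve 3 (λ c x y → c :* (x :- y) := (:- c) :* (y :- x)) refl c (a i) (a k)) (*-congʳ (sym s≈-c))))

  scaled-Δ-rigid : ∀ {d s s′ i k i′ k′} → Multiplier s → Multiplier s′
    → BaseDifference d i k → BaseDifference d i′ k′
    → from s * (a i - a k) ≈ from s′ * (a i′ - a k′) → s ≡ s′ × i ≡ i′
  scaled-Δ-rigid {d} {s} {s′} {i} {k} {i′} {k′} s∈S s′∈S (e , b , Δde≡ , diff) (e′ , b′ , Δde′≡ , diff′) scaled =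
    same-entry (e Fin.≟ e′)
    where
    w = from s * sign b
    w′ = from s′ * sign b′
    w≈w′ : w * Δ d e ≈ w′ * Δ d e′
    w≈w′ = begin
      w * Δ d e                   ≈⟨ *-assoc (from s) (sign b) (Δ d e) ⟩
      from s * (sign b * Δ d e)   ≈⟨ *-congˡ diff ⟨
      from s * (a i - a k)        ≈⟨ scaled ⟩
      from s′ * (a i′ - a k′)     ≈⟨ *-congˡ diff′ ⟩
      from s′ * (sign b′ * Δ d e′) ≈⟨ *-assoc (from s′) (sign b′) (Δ d e′) ⟨
      w′ * Δ d e′                 ∎
    same-orientation : e ≡ e′ → s ≡ s′ × b ≡ b′ → s ≡ s′ × i ≡ i′
    same-orientation ≡.refl (s≡s′ , ≡.refl) = s≡s′ , orient-injective b (≡.trans (≡.sym Δde≡) Δde′≡)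
    same-entry : Dec (e ≡ e′) → s ≡ s′ × i ≡ i′
    same-entry (no e≢e′) = ⊥-elim (Δ-distinct d e≢e′
      (SameCoset-scaled (InC6-* (proj₁ s∈S) (sign-C6 b)) (InC6-* (proj₁ s′∈S) (sign-C6 b′)) w≈w′))
    same-entry (yes ≡.refl) = same-orientation ≡.refl
      (Multiplier-rigid b b′ s∈S s′∈S (*-cancelʳ (Δ-nonZero d e) w≈w′))

  developed-unique : ∀ {j s t g j′ s′ t′ g′ p₁ p₂ p₁′ p₂′} → Multiplier s → Multiplier s′
    → p₁ ≢ p₂ → p₁′ ≢ p₂′
    → point (developed j s t g) p₁ ≡ point (developed j′ s′ t′ g′) p₁′
    → point (developed j s t g) p₂ ≡ point (developed j′ s′ t′ g′) p₂′
    → developed j s t g ≡ developed j′ s′ t′ g′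
  developed-unique {j} {s} {t} {g} {j′} {s′} {t′} {g′} {p₁} {p₂} {p₁′} {p₂′} s∈S s′∈S p₁≢p₂ p₁′≢p₂′ same₁ same₂ =
    conclude (scaled-Δ-rigid {label i ⊕ label k} {i = i} {k} {i′} {k′} s∈S s′∈S (base-difference j p₁≢p₂)
      (≡.subst (λ d → BaseDifference d i′ k′) same-label-difference (base-difference j′ p₁′≢p₂′)) scaled)
    where
    i = index j p₁
    k = index j p₂
    i′ = index j′ p₁′
    k′ = index j′ p₂′
    same-label-difference : label i′ ⊕ label k′ ≡ label i ⊕ label k
    same-label-difference = ≡.trans (≡.sym (⊕-difference (label i′) (label k′) g′))
      (≡.trans (≡.cong₂ _⊕_ (≡.sym (proj₂ (pt-injective same₁))) (≡.sym (proj₂ (pt-injective same₂))))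
               (⊕-difference (label i) (label k) g))
    scaled : from s * (a i - a k) ≈ from s′ * (a i′ - a k′)
    scaled = begin
      from s * (a i - a k)              ≈⟨ coord-difference s t i k ⟨
      coord s t i - coord s t k         ≈⟨ +-cong (proj₁ (pt-injective same₁)) (-‿cong (proj₁ (pt-injective same₂))) ⟩
      coord s′ t′ i′ - coord s′ t′ k′   ≈⟨ coord-difference s′ t′ i′ k′ ⟩
      from s′ * (a i′ - a k′)           ∎
    conclude : s ≡ s′ × i ≡ i′ → developed j s t g ≡ developed j′ s′ t′ g′
    conclude (≡.refl , i≡i′) = developed-determined i≡i′ same₁

  developed-meets-fibre-once : ∀ {j s t p p′ x} → Multiplier s
    → coord s t (index j p) ≈ x → coord s t (index j p′) ≈ x → p ≡ p′
  developed-meets-fibre-once {j} {s} {t} {p = p} {p′} (s∈C6 , _) p≈x p′≈x with p Fin.≟ p′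
  ... | yes p≡p′ = p≡p′
  ... | no p≢p′  = ⊥-elim (*-nonZero (InC6-nonZero s∈C6) (base-difference-nonZero j p≢p′)
                    (trans (sym (coord-difference s t (index j p) (index j p′))) (x≈y⇒x-y≈0 (trans p≈x (sym p′≈x)))))

  pair-unique : ∀ {π π′} → Valid π → Valid π′ → ∀ {p₁ p₂ p₁′ p₂′}
    → point π p₁ ≡ point π′ p₁′ → point π p₂ ≡ point π′ p₂′ → point π p₁ ≢ point π p₂ → π ≡ π′
  pair-unique {fibre t} {fibre t′} _ _ same₁ _ _ = ≡.cong fibre (from-injective (proj₁ (pt-injective same₁)))
  pair-unique {fibre t} {developed j′ s′ t′ g′} _ s′∈S {p₁′ = p₁′} {p₂′} same₁ same₂ distinct with
    developed-meets-fibre-once {j′} {s′} {t′} {p = p₁′} {p₂′} s′∈S (sym (proj₁ (pt-injective same₁))) (sym (proj₁ (pt-injective same₂)))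
  ... | ≡.refl = ⊥-elim (distinct (≡.trans same₁ (≡.sym same₂)))
  pair-unique {developed j s t g} {fibre t′} s∈S _ {p₁} {p₂} same₁ same₂ distinct with
    developed-meets-fibre-once {j} {s} {t} {p = p₁} {p₂} s∈S (proj₁ (pt-injective same₁)) (proj₁ (pt-injective same₂))
  ... | ≡.refl = ⊥-elim (distinct ≡.refl)
  pair-unique {π@(developed _ _ _ _)} {π′@(developed _ _ _ _)} s∈S s′∈S same₁ same₂ distinct =
    developed-unique s∈S s′∈S (λ p₁≡p₂ → distinct (≡.cong (point π) p₁≡p₂))
      (λ p₁′≡p₂′ → distinct (≡.trans same₁ (≡.trans (≡.cong (point π′) p₁′≡p₂′) (≡.sym same₂)))) same₁ same₂

  multiplier-*-a-≉sign : ∀ {s} i b → Multiplier s → ¬ (from s * a i ≈ sign b)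
  multiplier-*-a-≉sign i b (s∈C6 , _) sa≈± = ¬InC6-*-a i s∈C6 (InC6-resp (sym sa≈±) (sign-C6 b))

  nested-unique : ∀ {π π′} → Valid π → Valid π′ → ∀ {p p′}
    → nested π ≡ nested π′ → point π p ≡ point π′ p′ → π ≡ π′
  nested-unique {fibre t} {fibre t′} _ _ same-nested _ =
    ≡.cong fibre (from-injective (+-cancelʳ 1# (from t) (from t′) (proj₁ (pt-injective same-nested))))
  nested-unique {fibre t} {developed j′ s′ t′ g′} _ s′∈S {p′ = p′} same-nested same-point =
    ⊥-elim (multiplier-*-a-≉sign (index j′ p′) false s′∈S (begin
      from s′ * a (index j′ p′)                ≈⟨ coord-translation s′ t′ (index j′ p′) ⟨
      coord s′ t′ (index j′ p′) - from t′      ≈⟨ +-cong (proj₁ (pt-injective same-point)) (-‿cong (proj₁ (pt-injective same-nested))) ⟨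
      from t - (from t + 1#)                   ≈⟨ solve 1 (λ x → x :- (x :+ con (+ 1)) := :- con (+ 1)) refl (from t) ⟩
      - 1#                                     ∎))
  nested-unique {developed j s t g} {fibre t′} s∈S _ {p} {p′} same-nested same-point =
    ≡.sym (nested-unique {fibre t′} {developed j s t g} tt s∈S {p′} {p} (≡.sym same-nested) (≡.sym same-point))
  nested-unique {developed j s t g} {developed j′ s′ t′ g′} s∈S s′∈S {p} {p′} same-nested same-point =
    conclude (*-cancelʳ (a-nonZero i′) (trans (*-congˡ (reflexive (≡.cong a (≡.sym i≡i′)))) sa≈s′a′)) i≡i′
    where
    i = index j p
    i′ = index j′ p′
    sa≈s′a′ : from s * a i ≈ from s′ * a i′
    sa≈s′a′ = begin
      from s * a i          ≈⟨ coord-translation s t i ⟨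
      coord s t i - from t  ≈⟨ +-cong (proj₁ (pt-injective same-point)) (-‿cong (proj₁ (pt-injective same-nested))) ⟩
      coord s′ t′ i′ - from t′ ≈⟨ coord-translation s′ t′ i′ ⟩
      from s′ * a i′        ∎
    i≡i′ : i ≡ i′
    i≡i′ = InC6-*-a-injective (proj₁ s∈S) (proj₁ s′∈S)
      (⊕-injectiveʳ g (≡.trans (proj₂ (pt-injective same-point)) (≡.cong (label i′ ⊕_) (≡.sym (proj₂ (pt-injective same-nested))))))
      sa≈s′a′
    conclude : from s ≈ from s′ → i ≡ i′ → developed j s t g ≡ developed j′ s′ t′ g′
    conclude s≈s′ i≡i′ with from-injective s≈s′
    ... | ≡.refl = developed-determined i≡i′ same-point

  nested-crossing : ∀ {π π′} → Valid π → Valid π′ → ∀ {p p′}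
    → nested π ≡ point π′ p′ → point π p ≡ nested π′ → ⊥
  nested-crossing {fibre t} {fibre t′} _ _ nested≡ point≡ = 1+1≉0 (+-cancelˡ (from t) _ _ (begin
    from t + (1# + 1#)     ≈⟨ +-assoc (from t) 1# 1# ⟨
    from t + 1# + 1#       ≈⟨ +-congʳ (proj₁ (pt-injective nested≡)) ⟩
    from t′ + 1#           ≈⟨ proj₁ (pt-injective point≡) ⟨
    from t                 ≈⟨ +-identityʳ (from t) ⟨
    from t + 0#            ∎))
  nested-crossing {fibre t} {developed j′ s′ t′ g′} _ s′∈S {p′ = p′} nested≡ point≡ =
    multiplier-*-a-≉sign (index j′ p′) true s′∈S (begin
      from s′ * a (index j′ p′)            ≈⟨ coord-translation s′ t′ (index j′ p′) ⟨
      coord s′ t′ (index j′ p′) - from t′  ≈⟨ +-cong (proj₁ (pt-injective nested≡)) (-‿cong (proj₁ (pt-injective point≡))) ⟨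
      from t + 1# - from t                 ≈⟨ solve 1 (λ x → x :+ con (+ 1) :- x := con (+ 1)) refl (from t) ⟩
      1#                                   ∎)
  nested-crossing {developed j s t g} {fibre t′} s∈S _ {p} {p′} nested≡ point≡ =
    nested-crossing {fibre t′} {developed j s t g} tt s∈S {p′} {p} (≡.sym point≡) (≡.sym nested≡)
  nested-crossing {developed j s t g} {developed j′ s′ t′ g′} (s∈C6 , s+) (s′∈C6 , s′+) {p} {p′} nested≡ point≡ =
    Positive-≉-neg s+ s′+ (begin
      from s                  ≈⟨ *-cancelʳ (a-nonZero i) (trans sa≈-s′a′ (*-congˡ (reflexive (≡.cong a (≡.sym i≡i′))))) ⟩
      - 1# * from s′          ≈⟨ solve 1 (λ x → (:- con (+ 1)) :* x := :- x) refl (from s′) ⟩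
      - from s′               ∎)
    where
    i = index j p
    i′ = index j′ p′
    sa≈-s′a′ : from s * a i ≈ - 1# * from s′ * a i′
    sa≈-s′a′ = begin
      from s * a i             ≈⟨ coord-translation s t i ⟨
      coord s t i - from t     ≈⟨ +-cong (proj₁ (pt-injective point≡)) (-‿cong (proj₁ (pt-injective nested≡))) ⟩
      from t′ - coord s′ t′ i′ ≈⟨ solve 3 (λ t s x → t :- (s :* x :+ t) := (:- con (+ 1)) :* s :* x) refl (from t′) (from s′) (a i′) ⟩
      - 1# * from s′ * a i′    ∎
    i≡i′ : i ≡ i′
    i≡i′ = InC6-*-a-injective s∈C6 (InC6-* -1∈C6 s′∈C6)
      (⊕-loop (label i) (label i′) g′ (≡.trans (≡.cong (label i ⊕_) (≡.sym (proj₂ (pt-injective nested≡)))) (proj₂ (pt-injective point≡))))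
      sa≈-s′a′

  Param-code : Fin q ⊎ (Fin 4 × Fin q × Fin q × Fin 4) → Param
  Param-code (inj₁ t)               = fibre t
  Param-code (inj₂ (j , s , t , g)) = developed j s t g

  Param-decode : Param → Fin q ⊎ (Fin 4 × Fin q × Fin q × Fin 4)
  Param-decode (fibre t)           = inj₁ t
  Param-decode (developed j s t g) = inj₂ (j , s , t , g)

  Param-code-decode : ∀ π → Param-code (Param-decode π) ≡ π
  Param-code-decode (fibre _)           = ≡.refl
  Param-code-decode (developed _ _ _ _) = ≡.refl

  Param-decode-code : ∀ c → Param-decode (Param-code c) ≡ c
  Param-decode-code (inj₁ _) = ≡.refl
  Param-decode-code (inj₂ _) = ≡.refl

  Param↔ : Fin (q ℕ.+ 4 ℕ.* (q ℕ.* (q ℕ.* 4))) ↔ Param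
  Param↔ = ↔-trans Fin.+↔⊎ (↔-trans (↔-refl ⊎-↔ (↔-trans Fin.*↔× (↔-refl ×-↔ (↔-trans Fin.*↔× (↔-refl ×-↔ Fin.*↔×)))))
                                    (mk↔ₛ′ Param-code Param-decode Param-code-decode Param-decode-code))

  open Enumeration Param↔ using (enumerate; enumerate-unique; enumerate-complete)

  params : List Param
  params = filter Valid? enumerate

  params-unique : Unique params
  params-unique = Unique.filter⁺ Valid? enumerate-unique

  ∈-params⁻ : ∀ {π} → π ∈ params → Valid π
  ∈-params⁻ π∈ = proj₂ (∈-filter⁻ Valid? {xs = enumerate} π∈)

  ∈-params⁺ : ∀ {π} → Valid π → π ∈ params
  ∈-params⁺ {π} valid = ∈-filter⁺ Valid? (enumerate-complete π) valid

  block : Param → Vec (Fin v) 4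
  block π = Vec.tabulate (point π)

  ∈-block⁻ : ∀ π {X} → X ∈ Vec.toList (block π) → ∃ λ p → X ≡ point π p
  ∈-block⁻ π = ∈-tabulate⁻ {f = point π}

  ∈-block⁺ : ∀ π {X p} → X ≡ point π p → X ∈ Vec.toList (block π)
  ∈-block⁺ π {p = p} ≡.refl = ∈-tabulate⁺ {f = point π} p

  open import Data.List.Membership.DecPropositional (Fin._≟_ {v}) using (_∈?_)
  open ListCount

  InBoth : Fin v → Fin v → List (Fin v) → Set
  InBoth X Y B = X ∈ B × Y ∈ B

  inBoth? : ∀ X Y B → Dec (InBoth X Y B)
  inBoth? X Y B = X ∈? B ×-dec Y ∈? B

  count-inBoth : ∀ {X Y} → X ≢ Y → count (inBoth? X Y ∘ Vec.toList ∘ block) params ≡ 1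
  count-inBoth {X} {Y} X≢Y with pair-covered X≢Y
  ... | π , valid , (_ , X≡) , (_ , Y≡) =
    count≡1 (inBoth? X Y ∘ Vec.toList ∘ block) params-unique unique (∈-params⁺ valid) (∈-block⁺ π X≡ , ∈-block⁺ π Y≡)
    where
    unique : ∀ {π π′} → π ∈ params → π′ ∈ params → InBoth X Y (Vec.toList (block π)) → InBoth X Y (Vec.toList (block π′)) → π ≡ π′
    unique {π} {π′} π∈ π′∈ (X∈π , Y∈π) (X∈π′ , Y∈π′)
      with ∈-block⁻ π X∈π | ∈-block⁻ π Y∈π | ∈-block⁻ π′ X∈π′ | ∈-block⁻ π′ Y∈π′
    ... | _ , X≡π | _ , Y≡π | _ , X≡π′ | _ , Y≡π′ = pair-unique (∈-params⁻ π∈) (∈-params⁻ π′∈)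
      (≡.trans (≡.sym X≡π) X≡π′) (≡.trans (≡.sym Y≡π) Y≡π′) (λ same → X≢Y (≡.trans X≡π (≡.trans same (≡.sym Y≡π))))

  NestedAt : Fin v → Fin v → Param → Set
  NestedAt X Y π = (X ≡ nested π × Y ∈ Vec.toList (block π)) ⊎ (Y ≡ nested π × X ∈ Vec.toList (block π))

  nestedAt? : ∀ X Y π → Dec (NestedAt X Y π)
  nestedAt? X Y π = (X Fin.≟ nested π ×-dec Y ∈? Vec.toList (block π)) ⊎-dec (Y Fin.≟ nested π ×-dec X ∈? Vec.toList (block π))

  count-nestedAt : ∀ X Y → count (nestedAt? X Y) params ℕ.≤ 1
  count-nestedAt X Y = count≤1 (nestedAt? X Y) params-unique unique
    where
    unique : ∀ {π π′} → π ∈ params → π′ ∈ params → NestedAt X Y π → NestedAt X Y π′ → π ≡ π′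
    unique {π} {π′} π∈ π′∈ (inj₁ (X≡ , Y∈)) (inj₁ (X≡′ , Y∈′)) with ∈-block⁻ π Y∈ | ∈-block⁻ π′ Y∈′
    ... | _ , Y≡ | _ , Y≡′ = nested-unique (∈-params⁻ π∈) (∈-params⁻ π′∈) (≡.trans (≡.sym X≡) X≡′) (≡.trans (≡.sym Y≡) Y≡′)
    unique {π} {π′} π∈ π′∈ (inj₂ (Y≡ , X∈)) (inj₂ (Y≡′ , X∈′)) with ∈-block⁻ π X∈ | ∈-block⁻ π′ X∈′
    ... | _ , X≡ | _ , X≡′ = nested-unique (∈-params⁻ π∈) (∈-params⁻ π′∈) (≡.trans (≡.sym Y≡) Y≡′) (≡.trans (≡.sym X≡) X≡′)
    unique {π} {π′} π∈ π′∈ (inj₁ (X≡ , Y∈)) (inj₂ (Y≡′ , X∈′)) with ∈-block⁻ π Y∈ | ∈-block⁻ π′ X∈′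
    ... | _ , Y≡ | _ , X≡′ = ⊥-elim (nested-crossing (∈-params⁻ π∈) (∈-params⁻ π′∈) (≡.trans (≡.sym X≡) X≡′) (≡.trans (≡.sym Y≡) Y≡′))
    unique {π} {π′} π∈ π′∈ (inj₂ (Y≡ , X∈)) (inj₁ (X≡′ , Y∈′)) with ∈-block⁻ π X∈ | ∈-block⁻ π′ Y∈′
    ... | _ , X≡ | _ , Y≡′ = ⊥-elim (nested-crossing (∈-params⁻ π∈) (∈-params⁻ π′∈) (≡.trans (≡.sym Y≡) Y≡′) (≡.trans (≡.sym X≡) X≡′))

  withNested : Param → Vec (Fin v) 4 × Fin v
  withNested π = block π , nested π

  blocks : List (Vec (Fin v) 4 × Fin v)
  blocks = map withNested params

  augment : Vec (Fin v) 4 × Fin v → Vec (Fin v) 5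
  augment (B , p) = p Vec.∷ B

  design : IsBIBD v 4 1 (map proj₁ blocks)
  design = All.map⁺ (All.map⁺ (All.tabulate (λ π∈ → AllPairs.tabulate⁺ (point-injective (∈-params⁻ π∈))))) ,
    λ X Y X≢Y → ≡.trans (count-map (inBoth? X Y ∘ Vec.toList) proj₁ blocks)
                (≡.trans (count-map (inBoth? X Y ∘ Vec.toList ∘ proj₁) withNested params) (count-inBoth X≢Y))

  augmented : IsPartialBIBD v 5 2 (map augment blocks)
  augmented = All.map⁺ (All.map⁺ (All.tabulate (λ π∈ →
      All.tabulate⁺ (nested-∉ (∈-params⁻ π∈)) ∷ AllPairs.tabulate⁺ (point-injective (∈-params⁻ π∈))))) ,
    λ X Y X≢Y → ℕ.≤-trans (ℕ.≤-reflexive (≡.trans (count-map (inBoth? X Y ∘ Vec.toList) augment blocks)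
                                                  (count-map (inBoth? X Y ∘ Vec.toList ∘ augment) withNested params)))
                  (ℕ.≤-trans (count-⊎ _ (inBoth? X Y ∘ Vec.toList ∘ block) (nestedAt? X Y) (λ {π} → split {π = π} X≢Y) params)
                             (ℕ.+-mono-≤ (ℕ.≤-reflexive (count-inBoth X≢Y)) (count-nestedAt X Y)))
    where
    split : ∀ {X Y π} → X ≢ Y → InBoth X Y (nested π ∷ Vec.toList (block π))
          → InBoth X Y (Vec.toList (block π)) ⊎ NestedAt X Y π
    split X≢Y (here X≡  , here Y≡)  = ⊥-elim (X≢Y (≡.trans X≡ (≡.sym Y≡)))
    split X≢Y (here X≡  , there Y∈) = inj₂ (inj₁ (X≡ , Y∈))
    split X≢Y (there X∈ , here Y≡)  = inj₂ (inj₂ (Y≡ , X∈))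
    split X≢Y (there X∈ , there Y∈) = inj₁ (X∈ , Y∈)

lemma4p21 : (n : ℕ) → 1 ℕ.≤ n → (F : FiniteField (12 ℕ.* n ℕ.+ 1))
    → (a : Fin 16 → FiniteField.Carrier F)
    → Cyclotomy.Hypotheses F a
    → NestedBIBD (4 ℕ.* (12 ℕ.* n ℕ.+ 1)) 4 1
lemma4p21 n 1≤n F a hyp = record { blocks = blocks ; design = design ; nested = augmented }
  where open Construction 1≤n F a hyp
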